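{- Let $C_8,C_8'\subset\{0,1\}^8$ be two $(8,16,4)$-codes with $C_8\cap C_8'=\{00000000,11111111\}$, and let $$F=\{(x+y,\;x+z,\;x+y+z)\mid x\in C_8,\ y,z\in C_8'\}\subset\{0,1\}^{24}.$$ The distance coloring of $F$ (the map sending each $v\in\{0,1\}^{24}$ to $\min_{f\in F}\rho(v,f)$) is a perfect coloring of $Q_{24}$ and of $Q_{24}^{(2)}$, with colours ordered $0,1,2,3,4$ and parameter matrices respectively $$\begin{pmatrix}0&24&0&0&0\\1&0&23&0&0\\0&2&0&22&0\\0&0&3&0&21\\0&0&0&24&0\end{pmatrix}\quad\text{and}\quad\begin{pmatrix}0&0&276&0&0\\0&23&0&253&0\\1&0&44&0&231\\0&3&0&273&0\\0&0&36&0&240\end{pmatrix}.$$ In particular, its restriction to the graph $\frac12 Q_{24}'$ (odd-weight words) is a 2-coloring with parameters $((23,253)(3,273))$.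
   Context: Binary words of length $n$ are treated as vectors of $\mathbb{F}_2^n$ (addition mod 2). $\rho$ is the Hamming distance. An $(n,M,d)$-code is a set of $M$ words of length $n$ with pairwise distances at least $d$. $Q_{24}$: vertices $\{0,1\}^{24}$, adjacent iff at distance 1. $Q_{24}^{(2)}$: vertices $\{0,1\}^{24}$, adjacent iff at distance 2; it has two components, $\frac12 Q_{24}$ (even-weight words) and $\frac12 Q_{24}'$ (odd-weight words). A perfect coloring of a graph $G$ with parameter matrix $(s_{ij})$ is a surjective map $T:V(G)\to I$ such that every vertex of colour $i$ has exactly $s_{ij}$ neighbours of colour $j$; for a 2-colouring with parameters $((a,b)(c,d))$ the first colour is listed first. -}

module Defs where

open import Data.Bool using (Bool; true; false; _xor_; _∧_; if_then_else_)
open import Data.Nat using (ℕ; zero; suc; _+_; _⊓_; _≤_; _≡ᵇ_)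
open import Data.Fin using (Fin; _≟_)
open import Data.Vec using (Vec; []; _∷_; zipWith; replicate; _++_; lookup)
open import Data.List using (List; []; _∷_; map; concatMap; foldr)
open import Data.List.Relation.Unary.AllPairs using (AllPairs)
open import Data.Product using (Σ; ∃; _×_)
open import Relation.Binary.PropositionalEquality using (_≡_)
open import Relation.Nullary.Decidable using (⌊_⌋)

Word : ℕ → Set
Word n = Vec Bool n

_⊕_ : ∀ {n} → Word n → Word n → Word n
_⊕_ = zipWith _xor_
infixl 6 _⊕_

zeros : ∀ n → Word n
zeros n = replicate n false

ones : ∀ n → Word n
ones n = replicate n true

weight : ∀ {n} → Word n → ℕ
weight [] = 0
weight (true ∷ w) = suc (weight w)
weight (false ∷ w) = weight w

ρ : ∀ {n} → Word n → Word n → ℕ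
ρ u v = weight (u ⊕ v)

isOdd : ℕ → Bool
isOdd zero = false
isOdd (suc k) with isOdd k
... | true = false
... | false = true

oddWeight : ∀ {n} → Word n → Bool
oddWeight w = isOdd (weight w)

allWords : ∀ n → List (Word n)
allWords zero = [] ∷ []
allWords (suc n) = map (false ∷_) (allWords n) Data.List.++ map (true ∷_) (allWords n)

-- an (n,M,d)-code given as a list of its M codewords (pairwise distance ≥ d;
-- for d ≥ 1 this forces the M entries to be distinct)
IsCode : ∀ n (M d : ℕ) → List (Word n) → Set
IsCode n M d C = (Data.List.length C ≡ M) × AllPairs (λ a b → d ≤ ρ a b) C

Fset : List (Word 8) → List (Word 8) → List (Word 24)
Fset C C' =
  concatMap (λ x → concatMap (λ y → map (λ z → (x ⊕ y) ++ (x ⊕ z) ++ (x ⊕ y ⊕ z)) C') C') C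

-- distance from v to the (nonempty) list F: min over f ∈ F of ρ(v,f)
-- (initial value n is an upper bound of all distances, so irrelevant for nonempty F)
distTo : ∀ {n} → List (Word n) → Word n → ℕ
distTo {n} F v = foldr (λ f m → ρ v f ⊓ m) n F

-- graphs on {0,1}^n : Q_n (distance 1) and Q_n^(2) (distance 2)
adjQ : ∀ {n} → Word n → Word n → Bool
adjQ u v = ρ u v ≡ᵇ 1

adjQ2 : ∀ {n} → Word n → Word n → Bool
adjQ2 u v = ρ u v ≡ᵇ 2

countB : ∀ {A : Set} → (A → Bool) → List A → ℕ
countB p [] = 0
countB p (x ∷ xs) = if p x then suc (countB p xs) else countB p xs

PerfectColoring : ∀ {n k} (Vert : Word n → Bool) (adj : Word n → Word n → Bool)
  (T : Word n → Fin k) (S : Vec (Vec ℕ k) k) → Set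
PerfectColoring {n} {k} Vert adj T S =
  (∀ (j : Fin k) → ∃ λ v → Vert v ≡ true × T v ≡ j)
  × (∀ (v : Word n) → Vert v ≡ true → ∀ (j : Fin k) →
       countB (λ u → Vert u ∧ adj v u ∧ ⌊ T u ≟ j ⌋) (allWords n)
         ≡ lookup (lookup S (T v)) j)

allV : ∀ {n} → Word n → Bool
allV _ = true

M1 : Vec (Vec ℕ 5) 5
M1 = (0 ∷ 24 ∷ 0 ∷ 0 ∷ 0 ∷ [])
   ∷ (1 ∷ 0 ∷ 23 ∷ 0 ∷ 0 ∷ [])
   ∷ (0 ∷ 2 ∷ 0 ∷ 22 ∷ 0 ∷ [])
   ∷ (0 ∷ 0 ∷ 3 ∷ 0 ∷ 21 ∷ [])
   ∷ (0 ∷ 0 ∷ 0 ∷ 24 ∷ 0 ∷ [])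
   ∷ []

M2 : Vec (Vec ℕ 5) 5
M2 = (0 ∷ 0 ∷ 276 ∷ 0 ∷ 0 ∷ [])
   ∷ (0 ∷ 23 ∷ 0 ∷ 253 ∷ 0 ∷ [])
   ∷ (1 ∷ 0 ∷ 44 ∷ 0 ∷ 231 ∷ [])
   ∷ (0 ∷ 3 ∷ 0 ∷ 273 ∷ 0 ∷ [])
   ∷ (0 ∷ 0 ∷ 36 ∷ 0 ∷ 240 ∷ [])
   ∷ []

M3 : Vec (Vec ℕ 2) 2
M3 = (23 ∷ 253 ∷ []) ∷ (3 ∷ 273 ∷ []) ∷ []

module Submission where

open import Defs
open import Data.Bool using (Bool; true; false; not; _xor_; _∧_; _∨_; T; if_then_else_)
open import Data.Bool.ListAction using (any; all)
open import Data.Bool.Properties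
  using (xor-comm; xor-assoc; xor-identityʳ; not-distribˡ-xor; not-distribʳ-xor; not-involutive; T-≡;
         ∧-assoc; ∧-comm; ∧-conicalˡ; ∧-conicalʳ)
import Data.Bool.Properties as Bool
open import Data.Nat using (ℕ; zero; suc; pred; NonZero; _+_; _*_; _∸_; _^_; _⊓_; _≤_; _<_; _≡ᵇ_; _≤ᵇ_; z≤n; s≤s; _≤?_)
open import Data.Nat.Properties
open import Data.Nat.ListAction using (sum)
open import Data.Nat.Tactic.RingSolver using (solve-∀)
open import Data.Fin using (Fin; toℕ; fromℕ<; zero; suc)
open import Data.Fin.Properties using (toℕ-fromℕ<; toℕ-injective; toℕ<n)
import Data.Fin as Fin
open import Data.Vec using (Vec; []; _∷_; _++_; zipWith; lookup; tabulate)
open import Data.Vec.Properties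
  using (zipWith-comm; zipWith-assoc; zipWith-identityˡ; zipWith-identityʳ; zipWith-++; lookup∘tabulate; ≡-dec)
open import Data.List using (List; []; _∷_; map; concatMap; length; foldr; filterᵇ)
  renaming (_++_ to _++ₗ_)
open import Data.List.Properties using (length-++; length-map)
open import Data.List.Membership.Propositional using (_∈_; find; lose)
open import Data.List.Membership.Propositional.Properties
  using (∈-++⁺ˡ; ∈-++⁺ʳ; ∈-++⁻; ∈-map⁺; ∈-map⁻; ∈-∃++; ∈-concatMap⁺; ∈-concatMap⁻; ∈-filter⁻; ∈-filter⁺)
open import Data.List.Relation.Unary.Any using (Any; here; there)
open import Data.List.Relation.Unary.Any.Properties using (any⁺; any⁻)
open import Data.List.Relation.Unary.All using (All; []; _∷_)
import Data.List.Relation.Unary.All as All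
import Data.List.Relation.Unary.All.Properties as All
open import Data.List.Relation.Unary.All.Properties using (all⁺; all⁻)
open import Data.List.Relation.Unary.AllPairs using (AllPairs; []; _∷_)
import Data.List.Relation.Unary.AllPairs as AllPairs
import Data.List.Relation.Unary.AllPairs.Properties as AllPairs
open import Data.List.Relation.Unary.Unique.Propositional using (Unique)
import Data.List.Relation.Unary.Unique.Propositional.Properties as Unique
open import Data.Product using (Σ; ∃; _×_; _,_; proj₁; proj₂)
open import Data.Sum using (_⊎_; inj₁; inj₂; [_,_]′)
import Data.Sum as Sum
open import Data.Empty using (⊥; ⊥-elim)
open import Function.Bundles using (Equivalence)
open import Relation.Nullary using (¬_; Dec; yes; no)
open import Relation.Nullary.Decidable using (⌊_⌋; T?; decidable-stable; _×-dec_)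
open import Relation.Binary.PropositionalEquality

⊕-comm : ∀ {n} (u v : Word n) → u ⊕ v ≡ v ⊕ u
⊕-comm = zipWith-comm xor-comm

⊕-assoc : ∀ {n} (u v w : Word n) → (u ⊕ v) ⊕ w ≡ u ⊕ (v ⊕ w)
⊕-assoc = zipWith-assoc xor-assoc

⊕-identityˡ : ∀ {n} (u : Word n) → zeros n ⊕ u ≡ u
⊕-identityˡ = zipWith-identityˡ (λ _ → refl)

⊕-identityʳ : ∀ {n} (u : Word n) → u ⊕ zeros n ≡ u
⊕-identityʳ = zipWith-identityʳ xor-identityʳ

⊕-self : ∀ {n} (u : Word n) → u ⊕ u ≡ zeros n
⊕-self [] = refl
⊕-self (false ∷ u) = cong (false ∷_) (⊕-self u)
⊕-self (true ∷ u) = cong (false ∷_) (⊕-self u)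

⊕-involutiveˡ : ∀ {n} (u v : Word n) → u ⊕ (u ⊕ v) ≡ v
⊕-involutiveˡ u v = begin
  u ⊕ (u ⊕ v)  ≡⟨ ⊕-assoc u u v ⟨
  (u ⊕ u) ⊕ v  ≡⟨ cong (_⊕ v) (⊕-self u) ⟩
  zeros _ ⊕ v  ≡⟨ ⊕-identityˡ v ⟩
  v            ∎
  where open ≡-Reasoning

⊕-cancelˡ : ∀ {n} (u v w : Word n) → u ⊕ v ≡ u ⊕ w → v ≡ w
⊕-cancelˡ u v w eq = trans (sym (⊕-involutiveˡ u v)) (trans (cong (u ⊕_) eq) (⊕-involutiveˡ u w))

⊕≡zeros⇒≡ : ∀ {n} (u v : Word n) → u ⊕ v ≡ zeros n → u ≡ v
⊕≡zeros⇒≡ u v eq = ⊕-cancelˡ u u v (trans (⊕-self u) (sym eq))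

⊕-interchange : ∀ {n} (a b c d : Word n) → (a ⊕ b) ⊕ (c ⊕ d) ≡ (a ⊕ c) ⊕ (b ⊕ d)
⊕-interchange a b c d = begin
  (a ⊕ b) ⊕ (c ⊕ d) ≡⟨ ⊕-assoc a b (c ⊕ d) ⟩
  a ⊕ (b ⊕ (c ⊕ d)) ≡⟨ cong (a ⊕_) (⊕-assoc b c d) ⟨
  a ⊕ ((b ⊕ c) ⊕ d) ≡⟨ cong (λ x → a ⊕ (x ⊕ d)) (⊕-comm b c) ⟩
  a ⊕ ((c ⊕ b) ⊕ d) ≡⟨ cong (a ⊕_) (⊕-assoc c b d) ⟩
  a ⊕ (c ⊕ (b ⊕ d)) ≡⟨ ⊕-assoc a c (b ⊕ d) ⟨
  (a ⊕ c) ⊕ (b ⊕ d) ∎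
  where open ≡-Reasoning

⊕-++ : ∀ {m n} (u u' : Word m) (v v' : Word n) → (u ++ v) ⊕ (u' ++ v') ≡ (u ⊕ u') ++ (v ⊕ v')
⊕-++ u u' v v' = zipWith-++ _xor_ u v u' v'

weight≤n : ∀ {n} (w : Word n) → weight w ≤ n
weight≤n [] = z≤n
weight≤n (true ∷ w) = s≤s (weight≤n w)
weight≤n (false ∷ w) = m≤n⇒m≤1+n (weight≤n w)

weight-zeros : ∀ n → weight (zeros n) ≡ 0
weight-zeros zero = refl
weight-zeros (suc n) = weight-zeros n

weight≡0⇒zeros : ∀ {n} (w : Word n) → weight w ≡ 0 → w ≡ zeros n
weight≡0⇒zeros [] _ = refl
weight≡0⇒zeros (false ∷ w) eq = cong (false ∷_) (weight≡0⇒zeros w eq)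

weight-⊕-≤ : ∀ {n} (u v : Word n) → weight (u ⊕ v) ≤ weight u + weight v
weight-⊕-≤ [] [] = z≤n
weight-⊕-≤ (false ∷ u) (false ∷ v) = weight-⊕-≤ u v
weight-⊕-≤ (false ∷ u) (true ∷ v) = ≤-trans (s≤s (weight-⊕-≤ u v)) (≤-reflexive (sym (+-suc _ _)))
weight-⊕-≤ (true ∷ u) (false ∷ v) = s≤s (weight-⊕-≤ u v)
weight-⊕-≤ (true ∷ u) (true ∷ v) =
  ≤-trans (weight-⊕-≤ u v) (≤-trans (m≤n+m _ 2) (≤-reflexive (cong suc (sym (+-suc _ _)))))

weight-complement : ∀ {n} (w : Word n) → weight w + weight (w ⊕ ones n) ≡ n
weight-complement [] = refl
weight-complement (false ∷ w) = trans (+-suc (weight w) _) (cong suc (weight-complement w))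
weight-complement (true ∷ w) = cong suc (weight-complement w)

weight-++ : ∀ {m n} (u : Word m) (v : Word n) → weight (u ++ v) ≡ weight u + weight v
weight-++ [] v = refl
weight-++ (false ∷ u) v = weight-++ u v
weight-++ (true ∷ u) v = cong suc (weight-++ u v)

ρ-sym : ∀ {n} (u v : Word n) → ρ u v ≡ ρ v u
ρ-sym u v = cong weight (⊕-comm u v)

ρ-self : ∀ {n} (u : Word n) → ρ u u ≡ 0
ρ-self {n} u = trans (cong weight (⊕-self u)) (weight-zeros n)

ρ≡0⇒≡ : ∀ {n} (u v : Word n) → ρ u v ≡ 0 → u ≡ v
ρ≡0⇒≡ u v eq = ⊕≡zeros⇒≡ u v (weight≡0⇒zeros (u ⊕ v) eq)

ρ-triangle : ∀ {n} (u v w : Word n) → ρ u w ≤ ρ u v + ρ v w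
ρ-triangle u v w = subst (λ x → weight x ≤ ρ u v + ρ v w) telescope (weight-⊕-≤ (u ⊕ v) (v ⊕ w))
  where
  telescope : (u ⊕ v) ⊕ (v ⊕ w) ≡ u ⊕ w
  telescope = trans (⊕-assoc u v (v ⊕ w)) (cong (u ⊕_) (⊕-involutiveˡ v w))

ρ-zerosʳ : ∀ {n} (u : Word n) → ρ u (zeros n) ≡ weight u
ρ-zerosʳ u = cong weight (⊕-identityʳ u)

ρ-⊕ʳ : ∀ {n} (v e : Word n) → ρ v (v ⊕ e) ≡ weight e
ρ-⊕ʳ v e = cong weight (⊕-involutiveˡ v e)

ρ-⊕ˡ : ∀ {n} (v e : Word n) → ρ (v ⊕ e) v ≡ weight e
ρ-⊕ˡ v e = trans (ρ-sym (v ⊕ e) v) (ρ-⊕ʳ v e)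

ρ-++ : ∀ {m n} (u u' : Word m) (v v' : Word n) → ρ (u ++ v) (u' ++ v') ≡ ρ u u' + ρ v v'
ρ-++ u u' v v' = trans (cong weight (⊕-++ u u' v v')) (weight-++ (u ⊕ u') (v ⊕ v'))

isOdd-suc : ∀ k → isOdd (suc k) ≡ not (isOdd k)
isOdd-suc k with isOdd k
... | true = refl
... | false = refl

isOdd-+ : ∀ a b → isOdd (a + b) ≡ isOdd a xor isOdd b
isOdd-+ zero b = refl
isOdd-+ (suc a) b = begin
  isOdd (suc (a + b))          ≡⟨ isOdd-suc (a + b) ⟩
  not (isOdd (a + b))          ≡⟨ cong not (isOdd-+ a b) ⟩
  not (isOdd a xor isOdd b)    ≡⟨ not-distribˡ-xor (isOdd a) (isOdd b) ⟩
  not (isOdd a) xor isOdd b    ≡⟨ cong (_xor isOdd b) (isOdd-suc a) ⟨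
  isOdd (suc a) xor isOdd b    ∎
  where open ≡-Reasoning

xor-interchange : ∀ a b c d → (a xor b) xor (c xor d) ≡ (a xor c) xor (b xor d)
xor-interchange false false c d = refl
xor-interchange true false c d = not-distribˡ-xor c d
xor-interchange false true c d = not-distribʳ-xor c d
xor-interchange true true false d = sym (not-involutive d)
xor-interchange true true true d = refl

isOdd-weight-∷ : ∀ {n} b (w : Word n) → isOdd (weight (b ∷ w)) ≡ b xor isOdd (weight w)
isOdd-weight-∷ true w = isOdd-suc (weight w)
isOdd-weight-∷ false w = refl

isOdd-weight-⊕ : ∀ {n} (u v : Word n) → oddWeight (u ⊕ v) ≡ oddWeight u xor oddWeight v
isOdd-weight-⊕ [] [] = refl
isOdd-weight-⊕ (a ∷ u) (b ∷ v) = begin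
  isOdd (weight ((a xor b) ∷ (u ⊕ v)))          ≡⟨ isOdd-weight-∷ (a xor b) (u ⊕ v) ⟩
  (a xor b) xor oddWeight (u ⊕ v)               ≡⟨ cong ((a xor b) xor_) (isOdd-weight-⊕ u v) ⟩
  (a xor b) xor (oddWeight u xor oddWeight v)   ≡⟨ xor-interchange a b (oddWeight u) (oddWeight v) ⟩
  (a xor oddWeight u) xor (b xor oddWeight v)   ≡⟨ cong₂ _xor_ (isOdd-weight-∷ a u) (isOdd-weight-∷ b v) ⟨
  oddWeight (a ∷ u) xor oddWeight (b ∷ v)       ∎
  where open ≡-Reasoning

isOdd-ρ : ∀ {n} (u f : Word n) → oddWeight f ≡ false → isOdd (ρ u f) ≡ oddWeight u
isOdd-ρ u f even = trans (isOdd-weight-⊕ u f) (trans (cong (oddWeight u xor_) even) (xor-identityʳ _))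

𝟙 : Bool → ℕ
𝟙 true = 1
𝟙 false = 0

countB-++ : ∀ {A : Set} (p : A → Bool) xs ys → countB p (xs ++ₗ ys) ≡ countB p xs + countB p ys
countB-++ p [] ys = refl
countB-++ p (x ∷ xs) ys with p x
... | true = cong suc (countB-++ p xs ys)
... | false = countB-++ p xs ys

countB-map : ∀ {A B : Set} (p : B → Bool) (f : A → B) xs → countB p (map f xs) ≡ countB (λ x → p (f x)) xs
countB-map p f [] = refl
countB-map p f (x ∷ xs) with p (f x)
... | true = cong suc (countB-map p f xs)
... | false = countB-map p f xs

countB-cong : ∀ {A : Set} {p q : A → Bool} xs → (∀ x → x ∈ xs → p x ≡ q x) → countB p xs ≡ countB q xs
countB-cong [] h = refl
countB-cong {p = p} {q} (x ∷ xs) h with p x | q x | h x (here refl)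
... | true | true | _ = cong suc (countB-cong xs (λ y y∈ → h y (there y∈)))
... | false | false | _ = countB-cong xs (λ y y∈ → h y (there y∈))

countB-const : ∀ {A : Set} (b : Bool) (xs : List A) → countB (λ _ → b) xs ≡ length xs * 𝟙 b
countB-const b [] = refl
countB-const true (x ∷ xs) = cong suc (countB-const true xs)
countB-const false (x ∷ xs) = countB-const false xs

countB-none : ∀ {A : Set} {p : A → Bool} xs → (∀ x → x ∈ xs → p x ≡ false) → countB p xs ≡ 0
countB-none [] h = refl
countB-none {p = p} (x ∷ xs) h with p x | h x (here refl)
... | false | _ = countB-none xs (λ y y∈ → h y (there y∈))

countB-all : ∀ {A : Set} {p : A → Bool} xs → (∀ x → x ∈ xs → p x ≡ true) → countB p xs ≡ length xs
countB-all [] h = refl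
countB-all {p = p} (x ∷ xs) h with p x | h x (here refl)
... | true | _ = cong suc (countB-all xs (λ y y∈ → h y (there y∈)))

countB-complement : ∀ {A : Set} (p : A → Bool) xs → countB p xs + countB (λ x → not (p x)) xs ≡ length xs
countB-complement p [] = refl
countB-complement p (x ∷ xs) with p x
... | true = cong suc (countB-complement p xs)
... | false = trans (+-suc _ _) (cong suc (countB-complement p xs))

countB-complement′ : ∀ {A : Set} (p q : A → Bool) xs → (∀ x → x ∈ xs → q x ≡ not (p x)) →
  countB p xs + countB q xs ≡ length xs
countB-complement′ p q xs q≡¬p = trans (cong (countB p xs +_) (countB-cong xs q≡¬p)) (countB-complement p xs)

countB-∨ : ∀ {A : Set} (p q : A → Bool) xs → (∀ x → x ∈ xs → p x ≡ true → q x ≡ false) →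
  countB (λ x → p x ∨ q x) xs ≡ countB p xs + countB q xs
countB-∨ p q [] h = refl
countB-∨ p q (x ∷ xs) h with p x | q x | h x (here refl)
... | true | false | _ = cong suc (countB-∨ p q xs (λ y y∈ → h y (there y∈)))
... | true | true | disjoint with () ← disjoint refl
... | false | true | _ = trans (cong suc (countB-∨ p q xs (λ y y∈ → h y (there y∈)))) (sym (+-suc _ _))
... | false | false | _ = countB-∨ p q xs (λ y y∈ → h y (there y∈))

Unique-length≤countB : ∀ {A : Set} (p : A → Bool) (xs ys : List A) → Unique xs →
  (∀ x → x ∈ xs → x ∈ ys) → (∀ x → x ∈ xs → p x ≡ true) → length xs ≤ countB p ys
Unique-length≤countB p [] ys _ _ _ = z≤n
Unique-length≤countB p (x ∷ xs) ys (x∉xs ∷ uxs) xs⊆ys pxs with ∈-∃++ (xs⊆ys x (here refl))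
... | ys₁ , ys₂ , refl = ≤-trans (s≤s ih) (≤-reflexive (sym count-x))
  where
  xs⊆ys₁++ys₂ : ∀ z → z ∈ xs → z ∈ ys₁ ++ₗ ys₂
  xs⊆ys₁++ys₂ z z∈ with ∈-++⁻ ys₁ (xs⊆ys z (there z∈))
  ... | inj₁ m = ∈-++⁺ˡ m
  ... | inj₂ (here refl) = ⊥-elim (All.lookup x∉xs z∈ refl)
  ... | inj₂ (there m) = ∈-++⁺ʳ ys₁ m
  ih : length xs ≤ countB p (ys₁ ++ₗ ys₂)
  ih = Unique-length≤countB p xs (ys₁ ++ₗ ys₂) uxs xs⊆ys₁++ys₂ (λ z z∈ → pxs z (there z∈))
  count-x : countB p (ys₁ ++ₗ x ∷ ys₂) ≡ suc (countB p (ys₁ ++ₗ ys₂))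
  count-x rewrite countB-++ p ys₁ (x ∷ ys₂) | countB-++ p ys₁ ys₂ | pxs x (here refl) = +-suc _ _

countB-any : ∀ {A B : Set} (p : A → B → Bool) (G : List A) (E : List B) →
  AllPairs (λ g g' → ∀ e → e ∈ E → p g e ≡ true → p g' e ≡ false) G →
  countB (λ e → any (λ g → p g e) G) E ≡ sum (map (λ g → countB (p g) E) G)
countB-any p [] E _ = countB-none E (λ _ _ → refl)
countB-any p (g ∷ G) E (g-disjoint ∷ G-disjoint) =
  trans (countB-∨ (p g) (λ e → any (λ g' → p g' e) G) E none-in-G)
        (cong (countB (p g) E +_) (countB-any p G E G-disjoint))
  where
  none-in-G : ∀ e → e ∈ E → p g e ≡ true → any (λ g' → p g' e) G ≡ false
  none-in-G e e∈ pge = any-false G (All.map (λ disj → disj e e∈ pge) g-disjoint)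
    where
    any-false : ∀ G → All (λ g' → p g' e ≡ false) G → any (λ g' → p g' e) G ≡ false
    any-false [] [] = refl
    any-false (g' ∷ G) (pg'e ∷ rest) rewrite pg'e = any-false G rest

sum-const : ∀ {A : Set} (f : A → ℕ) (G : List A) c → (∀ g → g ∈ G → f g ≡ c) → sum (map f G) ≡ length G * c
sum-const f [] c h = refl
sum-const f (g ∷ G) c h rewrite h g (here refl) = cong (c +_) (sum-const f G c (λ x m → h x (there m)))

length-concatMap : ∀ {A B : Set} (h : A → List B) (xs : List A) c → (∀ x → x ∈ xs → length (h x) ≡ c) →
  length (concatMap h xs) ≡ length xs * c
length-concatMap h [] c _ = refl
length-concatMap h (x ∷ xs) c hl =
  trans (length-++ (h x)) (cong₂ _+_ (hl x (here refl)) (length-concatMap h xs c (λ y m → hl y (there m))))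

∈-concatMap⁻′ : ∀ {A B : Set} (h : A → List B) (xs : List A) {b} → b ∈ concatMap h xs → ∃ λ x → x ∈ xs × b ∈ h x
∈-concatMap⁻′ h xs m = find (∈-concatMap⁻ h {xs = xs} m)

∈-concatMap⁺′ : ∀ {A B : Set} {h : A → List B} {xs : List A} {x b} → x ∈ xs → b ∈ h x → b ∈ concatMap h xs
∈-concatMap⁺′ {h = h} x∈ b∈ = ∈-concatMap⁺ h (lose x∈ b∈)

Unique-concatMap : ∀ {A B : Set} (h : A → List B) (xs : List A) → Unique xs →
  (∀ x → x ∈ xs → Unique (h x)) →
  (∀ x y b → x ∈ xs → y ∈ xs → x ≢ y → b ∈ h x → b ∈ h y → ⊥) →
  Unique (concatMap h xs)
Unique-concatMap h [] _ _ _ = []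
Unique-concatMap h (x ∷ xs) (x∉xs ∷ uxs) uh disjoint =
  AllPairs.++⁺ (uh x (here refl))
    (Unique-concatMap h xs uxs (λ y y∈ → uh y (there y∈)) (λ y z b y∈ z∈ → disjoint y z b (there y∈) (there z∈)))
    (All.tabulate λ b∈hx → All.tabulate λ b'∈rest b≡b' → apart b∈hx b'∈rest b≡b')
  where
  apart : ∀ {b b'} → b ∈ h x → b' ∈ concatMap h xs → b ≡ b' → ⊥
  apart b∈hx b'∈rest refl with ∈-concatMap⁻′ h xs b'∈rest
  ... | y , y∈ , b∈hy = disjoint x y _ (here refl) (there y∈) (All.lookup x∉xs y∈) b∈hx b∈hy

Unique-map : ∀ {A B : Set} (f : A → B) (xs : List A) → Unique xs →
  (∀ x y → x ∈ xs → y ∈ xs → f x ≡ f y → x ≡ y) → Unique (map f xs)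
Unique-map f [] _ _ = []
Unique-map f (x ∷ xs) (x∉xs ∷ uxs) inj =
  All.map⁺ (All.tabulate λ {y} y∈ fx≡fy → All.lookup x∉xs y∈ (inj x y (here refl) (there y∈) fx≡fy))
  ∷ Unique-map f xs uxs (λ a b a∈ b∈ → inj a b (there a∈) (there b∈))

≡⇒≡ᵇ-true : ∀ {m n} → m ≡ n → (m ≡ᵇ n) ≡ true
≡⇒≡ᵇ-true {m} refl = Equivalence.to T-≡ (≡⇒≡ᵇ m m refl)

≡ᵇ-true⇒≡ : ∀ {m n} → (m ≡ᵇ n) ≡ true → m ≡ n
≡ᵇ-true⇒≡ {m} {n} eq = ≡ᵇ⇒≡ m n (Equivalence.from T-≡ eq)

≢⇒≡ᵇ-false : ∀ {m n} → m ≢ n → (m ≡ᵇ n) ≡ false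
≢⇒≡ᵇ-false {m} {n} m≢n with m ≡ᵇ n in eq
... | true = ⊥-elim (m≢n (≡ᵇ-true⇒≡ eq))
... | false = refl

_≟ʷ_ : ∀ {n} (u v : Word n) → Dec (u ≡ v)
_≟ʷ_ = ≡-dec Bool._≟_

ρ-⊕ˡ-weight : ∀ {n} (v e f : Word n) → ρ (v ⊕ e) f ≡ weight (e ⊕ (v ⊕ f))
ρ-⊕ˡ-weight v e f = cong weight (trans (cong (_⊕ f) (⊕-comm v e)) (⊕-assoc e v f))

firstOnes : ℕ → ∀ n → Word n
firstOnes k zero = []
firstOnes zero (suc n) = false ∷ firstOnes zero n
firstOnes (suc k) (suc n) = true ∷ firstOnes k n

weight-firstOnes : ∀ k n → k ≤ n → weight (firstOnes k n) ≡ k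
weight-firstOnes zero zero _ = refl
weight-firstOnes zero (suc n) _ = weight-firstOnes zero n z≤n
weight-firstOnes (suc k) (suc n) (s≤s k≤n) = cong suc (weight-firstOnes k n k≤n)

any-true⁺ : ∀ {A : Set} (p : A → Bool) {xs x} → x ∈ xs → p x ≡ true → any p xs ≡ true
any-true⁺ p x∈ px = Equivalence.to T-≡ (any⁺ p (lose x∈ (Equivalence.from T-≡ px)))

any-true⁻ : ∀ {A : Set} (p : A → Bool) xs → any p xs ≡ true → ∃ λ x → x ∈ xs × p x ≡ true
any-true⁻ p xs eq = let x , x∈ , px = find (any⁻ p xs (Equivalence.from T-≡ eq)) in x , x∈ , Equivalence.to T-≡ px

all-true⁻ : ∀ {A : Set} (p : A → Bool) xs {x} → all p xs ≡ true → x ∈ xs → p x ≡ true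
all-true⁻ p xs eq x∈ = Equivalence.to T-≡ (All.lookup (all⁺ p xs (Equivalence.from T-≡ eq)) x∈)

all-true⁺ : ∀ {A : Set} (p : A → Bool) xs → (∀ x → x ∈ xs → p x ≡ true) → all p xs ≡ true
all-true⁺ p xs h = Equivalence.to T-≡ (all⁻ p (All.tabulate λ {x} x∈ → Equivalence.from T-≡ (h x x∈)))

length-filterᵇ : ∀ {A : Set} (p : A → Bool) xs → length (filterᵇ p xs) ≡ countB p xs
length-filterᵇ p [] = refl
length-filterᵇ p (x ∷ xs) with p x
... | true = cong suc (length-filterᵇ p xs)
... | false = length-filterᵇ p xs

∈-allWords : ∀ {n} (w : Word n) → w ∈ allWords n
∈-allWords [] = here refl
∈-allWords (false ∷ w) = ∈-++⁺ˡ (∈-map⁺ (false ∷_) (∈-allWords w))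
∈-allWords {suc n} (true ∷ w) = ∈-++⁺ʳ (map (false ∷_) (allWords n)) (∈-map⁺ (true ∷_) (∈-allWords w))

countB-allWords-suc : ∀ n (p : Word (suc n) → Bool) →
  countB p (allWords (suc n)) ≡ countB (λ u → p (false ∷ u)) (allWords n) + countB (λ u → p (true ∷ u)) (allWords n)
countB-allWords-suc n p = trans (countB-++ p (map (false ∷_) (allWords n)) _)
  (cong₂ _+_ (countB-map p (false ∷_) (allWords n)) (countB-map p (true ∷_) (allWords n)))

length-allWords : ∀ n → length (allWords n) ≡ 2 ^ n
length-allWords zero = refl
length-allWords (suc n) = begin
  length (map (false ∷_) (allWords n) ++ₗ map (true ∷_) (allWords n))
    ≡⟨ length-++ (map (false ∷_) (allWords n)) ⟩
  length (map (false ∷_) (allWords n)) + length (map (true ∷_) (allWords n))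
    ≡⟨ cong₂ _+_ (length-map (false ∷_) (allWords n)) (length-map (true ∷_) (allWords n)) ⟩
  length (allWords n) + length (allWords n)
    ≡⟨ cong (λ x → x + x) (length-allWords n) ⟩
  2 ^ n + 2 ^ n
    ≡⟨ cong (2 ^ n +_) (+-identityʳ (2 ^ n)) ⟨
  2 ^ suc n ∎
  where open ≡-Reasoning

countB-oddWeight : ∀ n .{{_ : NonZero n}} → countB oddWeight (allWords n) ≡ 2 ^ pred n
countB-oddWeight (suc n) = begin
  countB oddWeight (allWords (suc n))
    ≡⟨ countB-allWords-suc n oddWeight ⟩
  countB oddWeight (allWords n) + countB (λ w → isOdd (suc (weight w))) (allWords n)
    ≡⟨ cong (countB oddWeight (allWords n) +_) (countB-cong (allWords n) (λ w _ → isOdd-suc (weight w))) ⟩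
  countB oddWeight (allWords n) + countB (λ w → not (oddWeight w)) (allWords n)
    ≡⟨ countB-complement oddWeight (allWords n) ⟩
  length (allWords n)
    ≡⟨ length-allWords n ⟩
  2 ^ n ∎
  where open ≡-Reasoning

sphere : ∀ n → ℕ → List (Word n)
sphere zero zero = [] ∷ []
sphere zero (suc k) = []
sphere (suc n) zero = map (false ∷_) (sphere n zero)
sphere (suc n) (suc k) = map (true ∷_) (sphere n k) ++ₗ map (false ∷_) (sphere n (suc k))

∈-sphere⁻ : ∀ {n} k {e : Word n} → e ∈ sphere n k → weight e ≡ k
∈-sphere⁻ {zero} zero {[]} _ = refl
∈-sphere⁻ {suc n} zero e∈ with ∈-map⁻ (false ∷_) e∈
... | e' , e'∈ , refl = ∈-sphere⁻ zero e'∈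
∈-sphere⁻ {suc n} (suc k) e∈ with ∈-++⁻ (map (true ∷_) (sphere n k)) e∈
... | inj₁ e∈₁ with ∈-map⁻ (true ∷_) e∈₁
...   | e' , e'∈ , refl = cong suc (∈-sphere⁻ k e'∈)
∈-sphere⁻ {suc n} (suc k) e∈ | inj₂ e∈₂ with ∈-map⁻ (false ∷_) e∈₂
...   | e' , e'∈ , refl = ∈-sphere⁻ (suc k) e'∈

∈-sphere⁺ : ∀ {n} k (e : Word n) → weight e ≡ k → e ∈ sphere n k
∈-sphere⁺ {zero} zero [] _ = here refl
∈-sphere⁺ {suc n} zero (false ∷ e) eq = ∈-map⁺ (false ∷_) (∈-sphere⁺ zero e eq)
∈-sphere⁺ {suc n} (suc k) (true ∷ e) eq = ∈-++⁺ˡ (∈-map⁺ (true ∷_) (∈-sphere⁺ k e (suc-injective eq)))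
∈-sphere⁺ {suc n} (suc k) (false ∷ e) eq =
  ∈-++⁺ʳ (map (true ∷_) (sphere n k)) (∈-map⁺ (false ∷_) (∈-sphere⁺ (suc k) e eq))

sphere-unique : ∀ n k → Unique (sphere n k)
sphere-unique zero zero = [] ∷ []
sphere-unique zero (suc k) = []
sphere-unique (suc n) zero = Unique-map (false ∷_) _ (sphere-unique n zero) (λ { _ _ _ _ refl → refl })
sphere-unique (suc n) (suc k) = AllPairs.++⁺
  (Unique-map (true ∷_) _ (sphere-unique n k) (λ { _ _ _ _ refl → refl }))
  (Unique-map (false ∷_) _ (sphere-unique n (suc k)) (λ { _ _ _ _ refl → refl }))
  (All.tabulate λ x∈ → All.tabulate λ y∈ → heads-differ x∈ y∈)
  where
  heads-differ : ∀ {x y} → x ∈ map (true ∷_) (sphere n k) → y ∈ map (false ∷_) (sphere n (suc k)) → x ≢ y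
  heads-differ x∈ y∈ x≡y with ∈-map⁻ (true ∷_) x∈ | ∈-map⁻ (false ∷_) y∈
  heads-differ x∈ y∈ () | _ , _ , refl | _ , _ , refl

countB-sphere-zero : ∀ n (P : Word n → Bool) → countB P (sphere n 0) ≡ 𝟙 (P (zeros n))
countB-sphere-zero zero P with P []
... | true = refl
... | false = refl
countB-sphere-zero (suc n) P = trans (countB-map P (false ∷_) (sphere n 0)) (countB-sphere-zero n (λ w → P (false ∷ w)))

countB-sphere-suc : ∀ n k (p : Word (suc n) → Bool) →
  countB p (sphere (suc n) (suc k)) ≡ countB (λ e → p (true ∷ e)) (sphere n k) + countB (λ e → p (false ∷ e)) (sphere n (suc k))
countB-sphere-suc n k p = trans (countB-++ p (map (true ∷_) (sphere n k)) _)
  (cong₂ _+_ (countB-map p (true ∷_) (sphere n k)) (countB-map p (false ∷_) (sphere n (suc k))))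

countB-ρ≡ᵇ : ∀ n k (v : Word n) (P : Word n → Bool) →
  countB (λ u → (ρ v u ≡ᵇ k) ∧ P u) (allWords n) ≡ countB (λ e → P (v ⊕ e)) (sphere n k)
countB-ρ≡ᵇ zero zero [] P = refl
countB-ρ≡ᵇ zero (suc k) [] P = refl
countB-ρ≡ᵇ (suc n) k (c ∷ v) P = trans (countB-allWords-suc n (λ u → (ρ (c ∷ v) u ≡ᵇ k) ∧ P u)) (split c k)
  where
  none : countB (λ _ → false) (allWords n) ≡ 0
  none = countB-none (allWords n) (λ _ _ → refl)
  split : ∀ c k → countB (λ u → (ρ (c ∷ v) (false ∷ u) ≡ᵇ k) ∧ P (false ∷ u)) (allWords n)
                  + countB (λ u → (ρ (c ∷ v) (true ∷ u) ≡ᵇ k) ∧ P (true ∷ u)) (allWords n)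
                ≡ countB (λ e → P ((c ∷ v) ⊕ e)) (sphere (suc n) k)
  split false zero = trans (cong₂ _+_ (countB-ρ≡ᵇ n zero v (λ u → P (false ∷ u))) none)
    (trans (+-identityʳ _) (sym (countB-map (λ e → P ((false ∷ v) ⊕ e)) (false ∷_) (sphere n zero))))
  split true zero = trans (cong (_+ countB (λ u → (ρ v u ≡ᵇ zero) ∧ P (true ∷ u)) (allWords n)) none) (trans (countB-ρ≡ᵇ n zero v (λ u → P (true ∷ u)))
    (sym (countB-map (λ e → P ((true ∷ v) ⊕ e)) (false ∷_) (sphere n zero))))
  split false (suc k) = trans (cong₂ _+_ (countB-ρ≡ᵇ n (suc k) v (λ u → P (false ∷ u))) (countB-ρ≡ᵇ n k v (λ u → P (true ∷ u))))
    (trans (+-comm (countB (λ e → P (false ∷ v ⊕ e)) (sphere n (suc k))) _) (sym (countB-sphere-suc n k (λ e → P ((false ∷ v) ⊕ e)))))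
  split true (suc k) = trans (cong₂ _+_ (countB-ρ≡ᵇ n k v (λ u → P (false ∷ u))) (countB-ρ≡ᵇ n (suc k) v (λ u → P (true ∷ u))))
    (sym (countB-sphere-suc n k (λ e → P ((true ∷ v) ⊕ e))))

choose₂ : ℕ → ℕ
choose₂ zero = 0
choose₂ (suc m) = m + choose₂ m

*-suc-pred : ∀ d (f : ℕ → ℕ) → d * f (suc (d ∸ 1)) ≡ d * f d
*-suc-pred zero f = refl
*-suc-pred (suc d) f = refl

choose₂-*-suc-pred : ∀ d (f : ℕ → ℕ) → choose₂ d * f (suc (d ∸ 2)) ≡ choose₂ d * f (d ∸ 1)
choose₂-*-suc-pred zero f = refl
choose₂-*-suc-pred (suc zero) f = refl
choose₂-*-suc-pred (suc (suc d)) f = refl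

-- Of the n words at distance 1 from a word of weight d, d have weight d ∸ 1 and n ∸ d have weight d + 1.
neighbourCount₁ : ℕ → ℕ → (ℕ → Bool) → ℕ
neighbourCount₁ n d Q = d * 𝟙 (Q (d ∸ 1)) + (n ∸ d) * 𝟙 (Q (suc d))

-- Of the words at distance 2 from a word of weight d, (d choose 2) have weight d ∸ 2, d (n ∸ d) have weight d
-- and (n ∸ d choose 2) have weight d + 2.
neighbourCount₂ : ℕ → ℕ → (ℕ → Bool) → ℕ
neighbourCount₂ n d Q = choose₂ d * 𝟙 (Q (d ∸ 2)) + d * (n ∸ d) * 𝟙 (Q d) + choose₂ (n ∸ d) * 𝟙 (Q (suc (suc d)))

countB-weight-sphere₁ : ∀ n (w : Word n) (Q : ℕ → Bool) →
  countB (λ e → Q (weight (e ⊕ w))) (sphere n 1) ≡ neighbourCount₁ n (weight w) Q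
countB-weight-sphere₁ zero [] Q = refl
countB-weight-sphere₁ (suc n) (c ∷ w) Q =
  trans (countB-sphere-suc n 0 (λ e → Q (weight (e ⊕ (c ∷ w)))))
        (trans (cong (_+ countB (λ e → Q (weight ((false ∷ e) ⊕ (c ∷ w)))) (sphere n 1)) (countB-sphere-zero n (λ e → Q (weight ((true ∷ e) ⊕ (c ∷ w)))))) (split c))
  where
  d = weight w
  M = n ∸ d
  split : ∀ c → 𝟙 (Q (weight ((true ∷ zeros n) ⊕ (c ∷ w)))) + countB (λ e → Q (weight ((false ∷ e) ⊕ (c ∷ w)))) (sphere n 1)
     ≡ neighbourCount₁ (suc n) (weight (c ∷ w)) Q
  split false rewrite ⊕-identityˡ w | countB-weight-sphere₁ n w Q | +-∸-assoc 1 (weight≤n w) =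
    arith (𝟙 (Q (d ∸ 1))) (𝟙 (Q (suc d))) d M
    where
    arith : ∀ X Y d M → Y + (d * X + M * Y) ≡ d * X + suc M * Y
    arith = solve-∀
  split true rewrite ⊕-identityˡ w | countB-weight-sphere₁ n w (λ x → Q (suc x)) | *-suc-pred d (λ x → 𝟙 (Q x)) =
    arith (𝟙 (Q d)) (𝟙 (Q (suc (suc d)))) d M
    where
    arith : ∀ X Y d M → X + (d * X + M * Y) ≡ suc d * X + M * Y
    arith = solve-∀

countB-weight-sphere₂ : ∀ n (w : Word n) (Q : ℕ → Bool) →
  countB (λ e → Q (weight (e ⊕ w))) (sphere n 2) ≡ neighbourCount₂ n (weight w) Q
countB-weight-sphere₂ zero [] Q = refl
countB-weight-sphere₂ (suc n) (c ∷ w) Q = trans (countB-sphere-suc n 1 (λ e → Q (weight (e ⊕ (c ∷ w))))) (split c)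
  where
  d = weight w
  M = n ∸ d
  split : ∀ c → countB (λ e → Q (weight ((true ∷ e) ⊕ (c ∷ w)))) (sphere n 1)
                + countB (λ e → Q (weight ((false ∷ e) ⊕ (c ∷ w)))) (sphere n 2)
     ≡ neighbourCount₂ (suc n) (weight (c ∷ w)) Q
  split false rewrite countB-weight-sphere₁ n w (λ x → Q (suc x)) | countB-weight-sphere₂ n w Q
                    | *-suc-pred d (λ x → 𝟙 (Q x)) | +-∸-assoc 1 (weight≤n w) =
    arith (𝟙 (Q d)) (𝟙 (Q (d ∸ 2))) (𝟙 (Q (suc (suc d)))) d M (choose₂ d) (choose₂ M)
    where
    arith : ∀ X Y Z d M A B → (d * X + M * Z) + (A * Y + d * M * X + B * Z) ≡ A * Y + d * suc M * X + (M + B) * Z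
    arith = solve-∀
  split true rewrite countB-weight-sphere₁ n w Q | countB-weight-sphere₂ n w (λ x → Q (suc x)) | choose₂-*-suc-pred d (λ x → 𝟙 (Q x)) =
    arith (𝟙 (Q (d ∸ 1))) (𝟙 (Q (suc d))) (𝟙 (Q (suc (suc (suc d))))) d M (choose₂ d) (choose₂ M)
    where
    arith : ∀ Y Z W d M A B → (d * Y + M * Z) + (A * Y + d * M * Z + B * W) ≡ (d + A) * Y + suc d * M * Z + B * W
    arith = solve-∀

countB-adjacent : ∀ n k (v : Word n) (V adj P : Word n → Bool) → (∀ u → adj u ≡ (ρ v u ≡ᵇ k)) →
  countB (λ u → V u ∧ adj u ∧ P u) (allWords n) ≡ countB (λ e → V (v ⊕ e) ∧ P (v ⊕ e)) (sphere n k)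
countB-adjacent n k v V adj P adj≡ =
  trans (countB-cong (allWords n) λ u _ → trans (cong (λ b → V u ∧ b ∧ P u) (adj≡ u)) (∧-swap (V u) (ρ v u ≡ᵇ k) (P u)))
        (countB-ρ≡ᵇ n k v (λ u → V u ∧ P u))
  where
  ∧-swap : ∀ a b c → a ∧ (b ∧ c) ≡ b ∧ (a ∧ c)
  ∧-swap a b c = trans (sym (∧-assoc a b c)) (trans (cong (_∧ c) (∧-comm a b)) (∧-assoc b a c))

AllPairs-lookup : ∀ {A : Set} {R : A → A → Set} {xs : List A} → (∀ {a b} → R a b → R b a) →
  AllPairs R xs → ∀ {a b} → a ∈ xs → b ∈ xs → a ≢ b → R a b
AllPairs-lookup sym' (_ ∷ _) (here refl) (here refl) a≢b = ⊥-elim (a≢b refl)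
AllPairs-lookup sym' (ra ∷ _) (here refl) (there b∈) _ = All.lookup ra b∈
AllPairs-lookup sym' (rb ∷ _) (there a∈) (here refl) _ = sym' (All.lookup rb a∈)
AllPairs-lookup sym' (_ ∷ rs) (there a∈) (there b∈) a≢b = AllPairs-lookup sym' rs a∈ b∈ a≢b

AllPairs-fromUnique : ∀ {A : Set} {R : A → A → Set} (xs : List A) → Unique xs →
  (∀ {x y} → x ∈ xs → y ∈ xs → x ≢ y → R x y) → AllPairs R xs
AllPairs-fromUnique [] _ _ = []
AllPairs-fromUnique (x ∷ xs) (x∉xs ∷ uxs) h =
  All.tabulate (λ y∈ → h (here refl) (there y∈) (All.lookup x∉xs y∈))
  ∷ AllPairs-fromUnique xs uxs (λ a∈ b∈ → h (there a∈) (there b∈))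

code-distance : ∀ {n d} {C : List (Word n)} → AllPairs (λ a b → d ≤ ρ a b) C →
  ∀ {a b} → a ∈ C → b ∈ C → a ≢ b → d ≤ ρ a b
code-distance = AllPairs-lookup (λ {a} {b} → subst (_ ≤_) (ρ-sym a b))

code-unique : ∀ {n d} {C : List (Word n)} → AllPairs (λ a b → suc d ≤ ρ a b) C → Unique C
code-unique = AllPairs.map λ {a} d<ρ a≡b → n≮0 (subst (_ ≤_) (trans (cong (ρ a) (sym a≡b)) (ρ-self a)) d<ρ)

distTo-≤ : ∀ {n} (F : List (Word n)) v {f} → f ∈ F → distTo F v ≤ ρ v f
distTo-≤ (g ∷ F) v (here refl) = m⊓n≤m _ _
distTo-≤ (g ∷ F) v (there f∈) = ≤-trans (m⊓n≤n _ _) (distTo-≤ F v f∈)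

distTo-attained : ∀ {n} (F : List (Word n)) v {f} → f ∈ F → ∃ λ g → g ∈ F × distTo F v ≡ ρ v g
distTo-attained {n} F v {f} f∈ with attained-or-initial F
  where
  attained-or-initial : ∀ F → distTo F v ≡ n ⊎ ∃ λ g → g ∈ F × distTo F v ≡ ρ v g
  attained-or-initial [] = inj₁ refl
  attained-or-initial (g ∷ F) with ⊓-sel (ρ v g) (distTo F v) | attained-or-initial F
  ... | inj₁ eq | _ = inj₂ (g , here refl , eq)
  ... | inj₂ eq | inj₁ eq' = inj₁ (trans eq eq')
  ... | inj₂ eq | inj₂ (h , h∈ , eq') = inj₂ (h , there h∈ , trans eq eq')
... | inj₂ attained = attained
... | inj₁ initial = f , f∈ , ≤-antisym (distTo-≤ F v f∈) (subst (ρ v f ≤_) (sym initial) (weight≤n (v ⊕ f)))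

distTo-Lipschitz : ∀ {n} (F : List (Word n)) {f} → f ∈ F → ∀ u v → distTo F v ≤ distTo F u + ρ u v
distTo-Lipschitz F f∈ u v with distTo-attained F u f∈
... | g , g∈ , eq = begin
  distTo F v     ≤⟨ distTo-≤ F v g∈ ⟩
  ρ v g          ≤⟨ ρ-triangle v u g ⟩
  ρ v u + ρ u g  ≡⟨ cong₂ _+_ (ρ-sym v u) (sym eq) ⟩
  ρ u v + distTo F u ≡⟨ +-comm (ρ u v) _ ⟩
  distTo F u + ρ u v ∎
  where open ≤-Reasoning

⌊≟⌋≡toℕ≡ᵇ : ∀ {k} (a b : Fin k) → ⌊ a Fin.≟ b ⌋ ≡ (toℕ a ≡ᵇ toℕ b)
⌊≟⌋≡toℕ≡ᵇ a b with a Fin.≟ b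
... | yes refl = sym (≡⇒≡ᵇ-true {toℕ a} refl)
... | no a≢b = sym (≢⇒≡ᵇ-false (λ eq → a≢b (toℕ-injective eq)))

module DistanceColouring (F : List (Word 24)) (F-code : IsCode 24 4096 8 F)
  (0∈F : zeros 24 ∈ F) (F-even : ∀ f → f ∈ F → oddWeight f ≡ false) where

  D : Word 24 → ℕ
  D = distTo F

  F-unique : Unique F
  F-unique = code-unique (proj₂ F-code)

  F-distance : ∀ {f g} → f ∈ F → g ∈ F → f ≢ g → 8 ≤ ρ f g
  F-distance = code-distance (proj₂ F-code)

  F-distance-via : ∀ u {f g} → f ∈ F → g ∈ F → f ≢ g → 8 ≤ ρ u f + ρ u g
  F-distance-via u {f} {g} f∈ g∈ f≢g =
    ≤-trans (F-distance f∈ g∈ f≢g) (subst (λ x → ρ f g ≤ x + ρ u g) (ρ-sym f u) (ρ-triangle f u g))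

  close-codewords-equal : ∀ u {f g} → f ∈ F → g ∈ F → ρ u f + ρ u g < 8 → f ≡ g
  close-codewords-equal u {f} {g} f∈ g∈ lt with f ≟ʷ g
  ... | yes f≡g = f≡g
  ... | no f≢g = ⊥-elim (<⇒≱ lt (F-distance-via u f∈ g∈ f≢g))

  D-≤ : ∀ v {f} → f ∈ F → D v ≤ ρ v f
  D-≤ v = distTo-≤ F v

  D-attained : ∀ v → ∃ λ g → g ∈ F × D v ≡ ρ v g
  D-attained v = distTo-attained F v 0∈F

  D-Lipschitz : ∀ u v → D v ≤ D u + ρ u v
  D-Lipschitz = distTo-Lipschitz F 0∈F

  D≡ρ : ∀ u {f} → f ∈ F → ρ u f ≤ 4 → D u ≡ ρ u f
  D≡ρ u {f} f∈ ρ≤4 with D-attained u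
  ... | g , g∈ , D≡ρug with g ≟ʷ f
  ...   | yes refl = D≡ρug
  ...   | no g≢f = ≤-antisym (D-≤ u f∈) (≤-trans ρ≤4 (+-cancelʳ-≤ 4 4 (D u) 8≤D+4))
    where
    8≤D+4 : 8 ≤ D u + 4
    8≤D+4 = ≤-trans (F-distance-via u g∈ f∈ g≢f) (+-mono-≤ (≤-reflexive (sym D≡ρug)) ρ≤4)

  isOdd-D : ∀ u → isOdd (D u) ≡ oddWeight u
  isOdd-D u with D-attained u
  ... | g , g∈ , D≡ρug = trans (cong isOdd D≡ρug) (isOdd-ρ u g (F-even g g∈))

  abstract
    odd-shell : List (Word 24)
    odd-shell = sphere 24 1 ++ₗ sphere 24 3

    odd-shell-weight : ∀ {e} → e ∈ odd-shell → weight e ≡ 1 ⊎ weight e ≡ 3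
    odd-shell-weight e∈ with ∈-++⁻ (sphere 24 1) e∈
    ... | inj₁ e∈₁ = inj₁ (∈-sphere⁻ 1 e∈₁)
    ... | inj₂ e∈₃ = inj₂ (∈-sphere⁻ 3 e∈₃)

    odd-shell-unique : Unique odd-shell
    odd-shell-unique = AllPairs.++⁺ (sphere-unique 24 1) (sphere-unique 24 3)
      (All.tabulate λ x∈ → All.tabulate λ y∈ x≡y → 1≢3 (trans (sym (∈-sphere⁻ 1 x∈)) (trans (cong weight x≡y) (∈-sphere⁻ 3 y∈))))
      where
      1≢3 : 1 ≢ 3
      1≢3 ()

    length-odd-shell : length odd-shell ≡ 2048
    length-odd-shell = refl

  -- Sphere packing: the 4096 translates of the odd words of weight at most 3 are pairwise disjoint and fill
  -- 4096 · (24 + 2024) = 2²³ odd words, which is all of them.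
  D-odd≤3 : ∀ u → oddWeight u ≡ true → D u ≤ 3
  D-odd≤3 u u-odd with D u ≤? 3
  ... | yes D≤3 = D≤3
  ... | no D≰3 = ⊥-elim (1+n≰n (begin
    suc (4096 * 2048)              ≡⟨ packed-size ⟨
    length packed                  ≤⟨ packed≤odd ⟩
    countB oddWeight (allWords 24) ≡⟨ countB-oddWeight 24 ⟩
    2 ^ 23                         ∎))
    where
    open ≤-Reasoning
    shell-≤3 : ∀ {e} → e ∈ odd-shell → weight e ≤ 3
    shell-≤3 e∈ with odd-shell-weight e∈
    ... | inj₁ w≡1 = ≤-trans (≤-reflexive w≡1) (s≤s z≤n)
    ... | inj₂ w≡3 = ≤-reflexive w≡3
    shell-odd : ∀ {e} → e ∈ odd-shell → oddWeight e ≡ true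
    shell-odd e∈ with odd-shell-weight e∈
    ... | inj₁ w≡1 = cong isOdd w≡1
    ... | inj₂ w≡3 = cong isOdd w≡3
    ball : Word 24 → List (Word 24)
    ball f = map (f ⊕_) odd-shell
    ∈-ball⁻ : ∀ {f b} → b ∈ ball f → ∃ λ e → e ∈ odd-shell × b ≡ f ⊕ e
    ∈-ball⁻ {f} = ∈-map⁻ (f ⊕_)
    balls-disjoint : ∀ f g b → f ∈ F → g ∈ F → f ≢ g → b ∈ ball f → b ∈ ball g → ⊥
    balls-disjoint f g b f∈ g∈ f≢g b∈f b∈g with ∈-ball⁻ b∈f | ∈-ball⁻ b∈g
    ... | e , e∈ , refl | e' , e'∈ , b≡ = <⇒≱ (≤-trans (s≤s (+-mono-≤ (shell-≤3 e∈) (shell-≤3 e'∈))) (n≤1+n 7))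
      (≤-trans (F-distance-via (f ⊕ e) f∈ g∈ f≢g) (≤-reflexive (cong₂ _+_ (ρ-⊕ˡ f e) (trans (cong (λ z → ρ z g) b≡) (ρ-⊕ˡ g e')))))
    far : ∀ f → f ∈ F → 4 ≤ ρ u f
    far f f∈ = ≤-trans (≰⇒> D≰3) (D-≤ u f∈)
    u∉balls : All (u ≢_) (concatMap ball F)
    u∉balls = All.tabulate λ b∈ u≡b → case b∈ u≡b
      where
      case : ∀ {b} → b ∈ concatMap ball F → u ≢ b
      case b∈ u≡b with ∈-concatMap⁻′ ball F b∈
      ... | f , f∈ , b∈f with ∈-ball⁻ b∈f
      ...   | e , e∈ , refl = <⇒≱ (s≤s (shell-≤3 e∈)) (subst (4 ≤_) (trans (cong (λ z → ρ z f) u≡b) (ρ-⊕ˡ f e)) (far f f∈))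
    packed : List (Word 24)
    packed = u ∷ concatMap ball F
    packed-unique : Unique packed
    packed-unique = u∉balls ∷ Unique-concatMap ball F F-unique
      (λ f _ → Unique-map (f ⊕_) odd-shell odd-shell-unique (λ x y _ _ → ⊕-cancelˡ f x y)) balls-disjoint
    packed-odd : ∀ x → x ∈ packed → oddWeight x ≡ true
    packed-odd x (here refl) = u-odd
    packed-odd x (there x∈) with ∈-concatMap⁻′ ball F x∈
    ... | f , f∈ , x∈f with ∈-ball⁻ x∈f
    ...   | e , e∈ , refl = trans (isOdd-weight-⊕ f e) (cong₂ _xor_ (F-even f f∈) (shell-odd e∈))
    packed-size : length packed ≡ suc (4096 * 2048)
    packed-size = cong suc (begin-equality
      length (concatMap ball F) ≡⟨ length-concatMap ball F 2048 (λ f _ → trans (length-map (f ⊕_) odd-shell) length-odd-shell) ⟩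
      length F * 2048           ≡⟨ cong (λ m → m * 2048) (proj₁ F-code) ⟩
      4096 * 2048               ∎)
    packed≤odd : length packed ≤ countB oddWeight (allWords 24)
    packed≤odd = Unique-length≤countB oddWeight packed (allWords 24) packed-unique (λ x _ → ∈-allWords x) packed-odd

  e₁ : Word 24
  e₁ = true ∷ zeros 23

  D≤4 : ∀ v → D v ≤ 4
  D≤4 v with oddWeight v in v-parity
  ... | true = m≤n⇒m≤1+n (D-odd≤3 v v-parity)
  ... | false = begin
    D v                   ≤⟨ D-Lipschitz (v ⊕ e₁) v ⟩
    D (v ⊕ e₁) + ρ (v ⊕ e₁) v ≡⟨ cong (D (v ⊕ e₁) +_) (ρ-⊕ˡ v e₁) ⟩
    D (v ⊕ e₁) + 1        ≤⟨ +-monoˡ-≤ 1 (D-odd≤3 (v ⊕ e₁) (trans (isOdd-weight-⊕ v e₁) (cong (_xor true) v-parity))) ⟩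
    4                     ∎
    where open ≤-Reasoning

  D≤3⊎D≡4 : ∀ v → D v ≤ 3 ⊎ D v ≡ 4
  D≤3⊎D≡4 v with m≤n⇒m<n∨m≡n (D≤4 v)
  ... | inj₁ D<4 = inj₁ (≤-pred D<4)
  ... | inj₂ D≡4 = inj₂ D≡4

  odd≤3⇒1⊎3 : ∀ {n} → n ≤ 3 → isOdd n ≡ true → n ≡ 1 ⊎ n ≡ 3
  odd≤3⇒1⊎3 {1} _ _ = inj₁ refl
  odd≤3⇒1⊎3 {3} _ _ = inj₂ refl
  odd≤3⇒1⊎3 {0} _ ()
  odd≤3⇒1⊎3 {2} _ ()
  odd≤3⇒1⊎3 {suc (suc (suc (suc _)))} (s≤s (s≤s (s≤s ()))) _

  D-odd : ∀ v → oddWeight v ≡ true → D v ≡ 1 ⊎ D v ≡ 3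
  D-odd v v-odd = odd≤3⇒1⊎3 (D-odd≤3 v v-odd) (trans (isOdd-D v) v-odd)

  -- For u within 2 of a word within 3 of f, either f is nearest to u, or ρ u f = 5 and then D u = 3.
  φ : ℕ → ℕ
  φ 5 = 3
  φ n = n

  φ-≤4 : ∀ {n} → n ≤ 4 → φ n ≡ n
  φ-≤4 {0} _ = refl
  φ-≤4 {1} _ = refl
  φ-≤4 {2} _ = refl
  φ-≤4 {3} _ = refl
  φ-≤4 {4} _ = refl
  φ-≤4 {suc (suc (suc (suc (suc _))))} (s≤s (s≤s (s≤s (s≤s ()))))

  D-near-5 : ∀ u v {f} → f ∈ F → ρ v f ≤ 3 → ρ u v ≤ 2 → ρ u f ≡ 5 → D u ≡ 3
  D-near-5 u v {f} f∈ ρvf≤3 ρuv≤2 ρuf≡5 with D-odd u (trans (sym (isOdd-ρ u f (F-even f f∈))) (cong isOdd ρuf≡5))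
  ... | inj₂ D≡3 = D≡3
  ... | inj₁ D≡1 with D-attained u
  ...   | g , g∈ , D≡ρug = ⊥-elim (5≢1 (trans (sym ρuf≡5) (trans (cong (ρ u) f≡g) ρug≡1)))
    where
    5≢1 : 5 ≢ 1
    5≢1 ()
    ρug≡1 : ρ u g ≡ 1
    ρug≡1 = trans (sym D≡ρug) D≡1
    ρvg≤3 : ρ v g ≤ 3
    ρvg≤3 = begin
      ρ v g         ≤⟨ ρ-triangle v u g ⟩
      ρ v u + ρ u g ≡⟨ cong₂ _+_ (ρ-sym v u) ρug≡1 ⟩
      ρ u v + 1     ≤⟨ +-monoˡ-≤ 1 ρuv≤2 ⟩
      3             ∎
      where open ≤-Reasoning
    f≡g : f ≡ g
    f≡g = close-codewords-equal v f∈ g∈ (s≤s (+-mono-≤ ρvf≤3 (m≤n⇒m≤1+n ρvg≤3)))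

  D-near : ∀ u v {f} → f ∈ F → ρ v f ≤ 3 → ρ u v ≤ 2 → D u ≡ φ (ρ u f)
  D-near u v {f} f∈ ρvf≤3 ρuv≤2 with ρ u f ≤? 4
  ... | yes ρuf≤4 = trans (D≡ρ u f∈ ρuf≤4) (sym (φ-≤4 ρuf≤4))
  ... | no ρuf≰4 = trans (D-near-5 u v f∈ ρvf≤3 ρuv≤2 ρuf≡5) (cong φ (sym ρuf≡5))
    where
    ρuf≡5 : ρ u f ≡ 5
    ρuf≡5 = ≤-antisym (≤-trans (ρ-triangle u v f) (+-mono-≤ ρuv≤2 ρvf≤3)) (≰⇒> ρuf≰4)

  countB-D-sphere : ∀ k → k ≤ 2 → ∀ v {f} → f ∈ F → ρ v f ≤ 3 → (P : ℕ → Bool) →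
    countB (λ e → P (D (v ⊕ e))) (sphere 24 k) ≡ countB (λ e → P (φ (weight (e ⊕ (v ⊕ f))))) (sphere 24 k)
  countB-D-sphere k k≤2 v {f} f∈ ρvf≤3 P = countB-cong (sphere 24 k) λ e e∈ →
    cong P (trans (D-near (v ⊕ e) v f∈ ρvf≤3 (≤-trans (≤-reflexive (trans (ρ-⊕ˡ v e) (∈-sphere⁻ k e∈))) k≤2))
                  (cong φ (ρ-⊕ˡ-weight v e f)))

  countB-D-sphere₁ : ∀ v (P : ℕ → Bool) → D v ≤ 3 →
    countB (λ e → P (D (v ⊕ e))) (sphere 24 1) ≡ neighbourCount₁ 24 (D v) (λ x → P (φ x))
  countB-D-sphere₁ v P D≤3 = let f , f∈ , D≡ρvf = D-attained v in begin
    countB (λ e → P (D (v ⊕ e))) (sphere 24 1)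
      ≡⟨ countB-D-sphere 1 (s≤s z≤n) v f∈ (subst (_≤ 3) D≡ρvf D≤3) P ⟩
    countB (λ e → P (φ (weight (e ⊕ (v ⊕ f))))) (sphere 24 1)
      ≡⟨ countB-weight-sphere₁ 24 (v ⊕ f) (λ x → P (φ x)) ⟩
    neighbourCount₁ 24 (ρ v f) (λ x → P (φ x))
      ≡⟨ cong (λ d → neighbourCount₁ 24 d (λ x → P (φ x))) D≡ρvf ⟨
    neighbourCount₁ 24 (D v) (λ x → P (φ x)) ∎
    where open ≡-Reasoning

  countB-D-sphere₂ : ∀ v (P : ℕ → Bool) → D v ≤ 3 →
    countB (λ e → P (D (v ⊕ e))) (sphere 24 2) ≡ neighbourCount₂ 24 (D v) (λ x → P (φ x))
  countB-D-sphere₂ v P D≤3 = let f , f∈ , D≡ρvf = D-attained v in begin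
    countB (λ e → P (D (v ⊕ e))) (sphere 24 2)
      ≡⟨ countB-D-sphere 2 ≤-refl v f∈ (subst (_≤ 3) D≡ρvf D≤3) P ⟩
    countB (λ e → P (φ (weight (e ⊕ (v ⊕ f))))) (sphere 24 2)
      ≡⟨ countB-weight-sphere₂ 24 (v ⊕ f) (λ x → P (φ x)) ⟩
    neighbourCount₂ 24 (ρ v f) (λ x → P (φ x))
      ≡⟨ cong (λ d → neighbourCount₂ 24 d (λ x → P (φ x))) D≡ρvf ⟨
    neighbourCount₂ 24 (D v) (λ x → P (φ x)) ∎
    where open ≡-Reasoning

  D≡4-even : ∀ v → D v ≡ 4 → oddWeight v ≡ false
  D≡4-even v D≡4 = trans (sym (isOdd-D v)) (cong isOdd D≡4)

  D≡4-lower : ∀ v → D v ≡ 4 → ∀ e → 4 ≤ D (v ⊕ e) + weight e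
  D≡4-lower v D≡4 e = subst₂ _≤_ D≡4 (cong (D (v ⊕ e) +_) (ρ-⊕ˡ v e)) (D-Lipschitz (v ⊕ e) v)

  D≡4-neighbour₁ : ∀ v → D v ≡ 4 → ∀ {e} → e ∈ sphere 24 1 → D (v ⊕ e) ≡ 3
  D≡4-neighbour₁ v D≡4 {e} e∈ = ≤-antisym (D-odd≤3 (v ⊕ e) odd) (≤-pred (subst (4 ≤_) (+-comm (D (v ⊕ e)) 1) lower))
    where
    w≡1 : weight e ≡ 1
    w≡1 = ∈-sphere⁻ 1 e∈
    odd : oddWeight (v ⊕ e) ≡ true
    odd = trans (isOdd-weight-⊕ v e) (cong₂ _xor_ (D≡4-even v D≡4) (cong isOdd w≡1))
    lower : 4 ≤ D (v ⊕ e) + 1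
    lower = subst (λ w → 4 ≤ D (v ⊕ e) + w) w≡1 (D≡4-lower v D≡4 e)

  even-2≤n≤4 : ∀ {n} → 2 ≤ n → n ≤ 4 → isOdd n ≡ false → n ≡ 2 ⊎ n ≡ 4
  even-2≤n≤4 {2} _ _ _ = inj₁ refl
  even-2≤n≤4 {4} _ _ _ = inj₂ refl
  even-2≤n≤4 {3} _ _ ()
  even-2≤n≤4 {suc (suc (suc (suc (suc _))))} _ (s≤s (s≤s (s≤s (s≤s ())))) _

  D≡4-neighbour₂ : ∀ v → D v ≡ 4 → ∀ {e} → e ∈ sphere 24 2 → D (v ⊕ e) ≡ 2 ⊎ D (v ⊕ e) ≡ 4
  D≡4-neighbour₂ v D≡4 {e} e∈ = even-2≤n≤4 (≤-pred (≤-pred (subst (4 ≤_) (+-comm (D (v ⊕ e)) 2) lower))) (D≤4 (v ⊕ e))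
    (trans (isOdd-D (v ⊕ e)) (trans (isOdd-weight-⊕ v e) (cong₂ _xor_ (D≡4-even v D≡4) (cong isOdd w≡2))))
    where
    w≡2 : weight e ≡ 2
    w≡2 = ∈-sphere⁻ 2 e∈
    lower : 4 ≤ D (v ⊕ e) + 2
    lower = subst (λ w → 4 ≤ D (v ⊕ e) + w) w≡2 (D≡4-lower v D≡4 e)

  -- The codewords at distance 4 from a deep hole v form a sextet: the 24 neighbours of v are each at distance 3
  -- from exactly one of them and every one of them accounts for 4 neighbours, so there are 6; the words at
  -- distance 2 from v and from F are those at distance 2 from one of the six, 6 for each.
  module Sextet (v : Word 24) (D≡4 : D v ≡ 4) where

    near : List (Word 24)
    near = filterᵇ (λ g → ρ v g ≡ᵇ 4) F

    ∈-near⁻ : ∀ {g} → g ∈ near → g ∈ F × ρ v g ≡ 4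
    ∈-near⁻ {g} g∈ = let g∈F , ρ≡ᵇ4 = ∈-filter⁻ (λ g → T? (ρ v g ≡ᵇ 4)) g∈ in g∈F , ≡ᵇ⇒≡ (ρ v g) 4 ρ≡ᵇ4

    ∈-near⁺ : ∀ {g} → g ∈ F → ρ v g ≤ 4 → g ∈ near
    ∈-near⁺ {g} g∈ ρ≤4 = ∈-filter⁺ (λ g → T? (ρ v g ≡ᵇ 4)) g∈
      (≡⇒≡ᵇ (ρ v g) 4 (≤-antisym ρ≤4 (subst (_≤ ρ v g) D≡4 (D-≤ v g∈))))

    near-unique : Unique near
    near-unique = Unique.filter⁺ (λ g → T? (ρ v g ≡ᵇ 4)) F-unique

    near-disjoint : ∀ k → k + k < 8 → (E : List (Word 24)) →
      AllPairs (λ g g' → ∀ e → e ∈ E → (ρ (v ⊕ e) g ≡ᵇ k) ≡ true → (ρ (v ⊕ e) g' ≡ᵇ k) ≡ false) near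
    near-disjoint k k+k<8 E = AllPairs-fromUnique near near-unique λ {g} {g'} g∈ g'∈ g≢g' e _ ρg≡k →
      ≢⇒≡ᵇ-false {ρ (v ⊕ e) g'} λ ρg'≡k → g≢g' (close-codewords-equal (v ⊕ e) (proj₁ (∈-near⁻ g∈)) (proj₁ (∈-near⁻ g'∈))
        (subst₂ (λ a b → a + b < 8) (sym (≡ᵇ-true⇒≡ {ρ (v ⊕ e) g} ρg≡k)) (sym ρg'≡k) k+k<8))

    nearest∈near : ∀ e → D (v ⊕ e) + weight e ≤ 4 → ∃ λ g → g ∈ near × ρ (v ⊕ e) g ≡ D (v ⊕ e)
    nearest∈near e bound = let g , g∈ , D≡ρ = D-attained (v ⊕ e) in g , ∈-near⁺ g∈ (begin
      ρ v g                 ≤⟨ ρ-triangle v (v ⊕ e) g ⟩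
      ρ v (v ⊕ e) + ρ (v ⊕ e) g ≡⟨ cong₂ _+_ (ρ-⊕ʳ v e) (sym D≡ρ) ⟩
      weight e + D (v ⊕ e)  ≡⟨ +-comm (weight e) _ ⟩
      D (v ⊕ e) + weight e  ≤⟨ bound ⟩
      4                     ∎) , sym D≡ρ
      where open ≤-Reasoning

    countB-ρ-sphere : ∀ {g} → g ∈ near → ∀ k (Q : ℕ → Bool) →
      countB (λ e → Q (ρ (v ⊕ e) g)) (sphere 24 k) ≡ countB (λ e → Q (weight (e ⊕ (v ⊕ g)))) (sphere 24 k)
    countB-ρ-sphere {g} _ k Q = countB-cong (sphere 24 k) (λ e _ → cong Q (ρ-⊕ˡ-weight v e g))

    at-distance-3 : ∀ {g} → g ∈ near → countB (λ e → ρ (v ⊕ e) g ≡ᵇ 3) (sphere 24 1) ≡ 4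
    at-distance-3 {g} g∈ = trans (countB-ρ-sphere g∈ 1 (_≡ᵇ 3))
      (trans (countB-weight-sphere₁ 24 (v ⊕ g) (_≡ᵇ 3)) (cong (λ d → neighbourCount₁ 24 d (_≡ᵇ 3)) (proj₂ (∈-near⁻ g∈))))

    at-distance-2 : ∀ {g} → g ∈ near → countB (λ e → ρ (v ⊕ e) g ≡ᵇ 2) (sphere 24 2) ≡ 6
    at-distance-2 {g} g∈ = trans (countB-ρ-sphere g∈ 2 (_≡ᵇ 2))
      (trans (countB-weight-sphere₂ 24 (v ⊕ g) (_≡ᵇ 2)) (cong (λ d → neighbourCount₂ 24 d (_≡ᵇ 2)) (proj₂ (∈-near⁻ g∈))))

    neighbour-covered : ∀ e → e ∈ sphere 24 1 → any (λ g → ρ (v ⊕ e) g ≡ᵇ 3) near ≡ true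
    neighbour-covered e e∈ = let g , g∈ , ρ≡D = nearest∈near e bound in
      any-true⁺ (λ g → ρ (v ⊕ e) g ≡ᵇ 3) g∈ (≡⇒≡ᵇ-true (trans ρ≡D D≡3))
      where
      D≡3 : D (v ⊕ e) ≡ 3
      D≡3 = D≡4-neighbour₁ v D≡4 e∈
      bound : D (v ⊕ e) + weight e ≤ 4
      bound = ≤-reflexive (cong₂ _+_ D≡3 (∈-sphere⁻ 1 e∈))

    length-near : length near ≡ 6
    length-near = *-cancelʳ-≡ (length near) 6 4 (begin
      length near * 4
        ≡⟨ sum-const _ near 4 (λ g g∈ → at-distance-3 g∈) ⟨
      sum (map (λ g → countB (λ e → ρ (v ⊕ e) g ≡ᵇ 3) (sphere 24 1)) near)
        ≡⟨ countB-any (λ g e → ρ (v ⊕ e) g ≡ᵇ 3) near (sphere 24 1) (near-disjoint 3 (s≤s (s≤s (s≤s (s≤s (s≤s (s≤s (s≤s z≤n))))))) (sphere 24 1)) ⟨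
      countB (λ e → any (λ g → ρ (v ⊕ e) g ≡ᵇ 3) near) (sphere 24 1)
        ≡⟨ countB-all (sphere 24 1) neighbour-covered ⟩
      24 ∎)
      where open ≡-Reasoning

    D≡2⇔near : ∀ e → e ∈ sphere 24 2 → (D (v ⊕ e) ≡ᵇ 2) ≡ any (λ g → ρ (v ⊕ e) g ≡ᵇ 2) near
    D≡2⇔near e e∈ with D≡4-neighbour₂ v D≡4 e∈
    ... | inj₁ D≡2 = let g , g∈ , ρ≡D = nearest∈near e (≤-reflexive (cong₂ _+_ D≡2 (∈-sphere⁻ 2 e∈))) in
      trans (≡⇒≡ᵇ-true D≡2) (sym (any-true⁺ (λ g → ρ (v ⊕ e) g ≡ᵇ 2) g∈ (≡⇒≡ᵇ-true (trans ρ≡D D≡2))))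
    ... | inj₂ D≡4′ = trans (≢⇒≡ᵇ-false (λ D≡2 → 4≢2 (trans (sym D≡4′) D≡2))) (sym (any-false _ refl))
      where
      4≢2 : 4 ≢ 2
      4≢2 ()
      any-false : ∀ b → any (λ g → ρ (v ⊕ e) g ≡ᵇ 2) near ≡ b → b ≡ false
      any-false false _ = refl
      any-false true any≡true = let g , g∈ , ρ≡ᵇ2 = any-true⁻ (λ g → ρ (v ⊕ e) g ≡ᵇ 2) near any≡true in
        ⊥-elim (<⇒≱ (s≤s (s≤s (s≤s z≤n)))
          (subst₂ _≤_ D≡4′ (≡ᵇ-true⇒≡ ρ≡ᵇ2) (D-≤ (v ⊕ e) (proj₁ (∈-near⁻ g∈)))))

    count-D≡2 : countB (λ e → D (v ⊕ e) ≡ᵇ 2) (sphere 24 2) ≡ 36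
    count-D≡2 = begin
      countB (λ e → D (v ⊕ e) ≡ᵇ 2) (sphere 24 2)
        ≡⟨ countB-cong (sphere 24 2) D≡2⇔near ⟩
      countB (λ e → any (λ g → ρ (v ⊕ e) g ≡ᵇ 2) near) (sphere 24 2)
        ≡⟨ countB-any (λ g e → ρ (v ⊕ e) g ≡ᵇ 2) near (sphere 24 2) (near-disjoint 2 (s≤s (s≤s (s≤s (s≤s (s≤s z≤n))))) (sphere 24 2)) ⟩
      sum (map (λ g → countB (λ e → ρ (v ⊕ e) g ≡ᵇ 2) (sphere 24 2)) near)
        ≡⟨ sum-const _ near 6 (λ g g∈ → at-distance-2 g∈) ⟩
      length near * 6
        ≡⟨ cong (_* 6) length-near ⟩
      36 ∎
      where open ≡-Reasoning

    none : ∀ c → c ≢ 2 → c ≢ 4 → countB (λ e → D (v ⊕ e) ≡ᵇ c) (sphere 24 2) ≡ 0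
    none c c≢2 c≢4 = countB-none (sphere 24 2) λ e e∈ → ≢⇒≡ᵇ-false λ D≡c → neither (D≡4-neighbour₂ v D≡4 e∈) D≡c
      where
      neither : ∀ {x} → x ≡ 2 ⊎ x ≡ 4 → x ≡ c → ⊥
      neither (inj₁ x≡2) x≡c = c≢2 (trans (sym x≡c) x≡2)
      neither (inj₂ x≡4) x≡c = c≢4 (trans (sym x≡c) x≡4)

    D≡4⇔not2 : ∀ e → e ∈ sphere 24 2 → (D (v ⊕ e) ≡ᵇ 4) ≡ not (D (v ⊕ e) ≡ᵇ 2)
    D≡4⇔not2 e e∈ = [ (λ D≡2 → subst P (sym D≡2) refl) , (λ D≡4′ → subst P (sym D≡4′) refl) ]′ (D≡4-neighbour₂ v D≡4 e∈)
      where
      P : ℕ → Set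
      P d = (d ≡ᵇ 4) ≡ not (d ≡ᵇ 2)

    partition : countB (λ e → D (v ⊕ e) ≡ᵇ 2) (sphere 24 2) + countB (λ e → D (v ⊕ e) ≡ᵇ 4) (sphere 24 2) ≡ 276
    partition = countB-complement′ (λ e → D (v ⊕ e) ≡ᵇ 2) (λ e → D (v ⊕ e) ≡ᵇ 4) (sphere 24 2) D≡4⇔not2

    count-D≡4 : countB (λ e → D (v ⊕ e) ≡ᵇ 4) (sphere 24 2) ≡ 240
    count-D≡4 = +-cancelˡ-≡ 36 (countB (λ e → D (v ⊕ e) ≡ᵇ 4) (sphere 24 2)) 240
      (subst (λ a → a + countB (λ e → D (v ⊕ e) ≡ᵇ 4) (sphere 24 2) ≡ 276) count-D≡2 partition)

    count-row₂ : ∀ c → Dec (c ≡ 2) → Dec (c ≡ 4) →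
      countB (λ e → D (v ⊕ e) ≡ᵇ c) (sphere 24 2) ≡ 36 * 𝟙 (c ≡ᵇ 2) + 240 * 𝟙 (c ≡ᵇ 4)
    count-row₂ .2 (yes refl) _ = count-D≡2
    count-row₂ .4 (no _) (yes refl) = count-D≡4
    count-row₂ c (no c≢2) (no c≢4) =
      trans (none c c≢2 c≢4) (sym (cong₂ (λ a b → 36 * 𝟙 a + 240 * 𝟙 b) (≢⇒≡ᵇ-false c≢2) (≢⇒≡ᵇ-false c≢4)))

  colour : Word 24 → Fin 5
  colour v = fromℕ< (s≤s (D≤4 v))

  toℕ-colour : ∀ v → toℕ (colour v) ≡ D v
  toℕ-colour v = toℕ-fromℕ< (s≤s (D≤4 v))

  colour≡4 : ∀ v → D v ≡ 4 → colour v ≡ Fin.fromℕ 4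
  colour≡4 v D≡4 = toℕ-injective (trans (toℕ-colour v) D≡4)

  M1-row : ∀ (i : Fin 5) → toℕ i ≤ 3 → lookup M1 i ≡ tabulate (λ j → neighbourCount₁ 24 (toℕ i) (λ x → φ x ≡ᵇ toℕ j))
  M1-row zero _ = refl
  M1-row (suc zero) _ = refl
  M1-row (suc (suc zero)) _ = refl
  M1-row (suc (suc (suc zero))) _ = refl
  M1-row (suc (suc (suc (suc zero)))) (s≤s (s≤s (s≤s ())))

  M2-row : ∀ (i : Fin 5) → toℕ i ≤ 3 → lookup M2 i ≡ tabulate (λ j → neighbourCount₂ 24 (toℕ i) (λ x → φ x ≡ᵇ toℕ j))
  M2-row zero _ = refl
  M2-row (suc zero) _ = refl
  M2-row (suc (suc zero)) _ = refl
  M2-row (suc (suc (suc zero))) _ = refl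
  M2-row (suc (suc (suc (suc zero)))) (s≤s (s≤s (s≤s ())))

  count-row≤3 : ∀ (M : Vec (Vec ℕ 5) 5) (count : ℕ → (ℕ → Bool) → ℕ) k v j → D v ≤ 3 →
    (∀ (i : Fin 5) → toℕ i ≤ 3 → lookup M i ≡ tabulate (λ j → count (toℕ i) (λ x → φ x ≡ᵇ toℕ j))) →
    countB (λ e → D (v ⊕ e) ≡ᵇ toℕ j) (sphere 24 k) ≡ count (D v) (λ x → φ x ≡ᵇ toℕ j) →
    countB (λ e → D (v ⊕ e) ≡ᵇ toℕ j) (sphere 24 k) ≡ lookup (lookup M (colour v)) j
  count-row≤3 M count k v j D≤3 M-row counted = begin
    countB (λ e → D (v ⊕ e) ≡ᵇ toℕ j) (sphere 24 k)     ≡⟨ counted ⟩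
    count (D v) (λ x → φ x ≡ᵇ toℕ j)                   ≡⟨ cong (λ d → count d (λ x → φ x ≡ᵇ toℕ j)) (toℕ-colour v) ⟨
    count (toℕ (colour v)) (λ x → φ x ≡ᵇ toℕ j)        ≡⟨ lookup∘tabulate (λ j → count (toℕ (colour v)) (λ x → φ x ≡ᵇ toℕ j)) j ⟨
    lookup (tabulate (λ j → count (toℕ (colour v)) (λ x → φ x ≡ᵇ toℕ j))) j
                                                       ≡⟨ cong (λ r → lookup r j) (M-row (colour v) (subst (_≤ 3) (sym (toℕ-colour v)) D≤3)) ⟨
    lookup (lookup M (colour v)) j                     ∎
    where open ≡-Reasoning

  at-deep-hole : ∀ v (M : Vec (Vec ℕ 5) 5) j {n} → D v ≡ 4 →
    n ≡ lookup (lookup M (Fin.fromℕ 4)) j → n ≡ lookup (lookup M (colour v)) j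
  at-deep-hole v M j D≡4 eq = trans eq (cong (λ i → lookup (lookup M i) j) (sym (colour≡4 v D≡4)))

  count-row₁-deep : ∀ v → D v ≡ 4 → ∀ j →
    countB (λ e → D (v ⊕ e) ≡ᵇ toℕ j) (sphere 24 1) ≡ lookup (lookup M1 (Fin.fromℕ 4)) j
  count-row₁-deep v D≡4 j = begin
    countB (λ e → D (v ⊕ e) ≡ᵇ toℕ j) (sphere 24 1)
      ≡⟨ countB-cong {p = λ e → D (v ⊕ e) ≡ᵇ toℕ j} {q = λ _ → 3 ≡ᵇ toℕ j} (sphere 24 1)
           (λ e e∈ → cong (_≡ᵇ toℕ j) (D≡4-neighbour₁ v D≡4 e∈)) ⟩
    countB (λ _ → 3 ≡ᵇ toℕ j) (sphere 24 1)
      ≡⟨ countB-const (3 ≡ᵇ toℕ j) (sphere 24 1) ⟩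
    24 * 𝟙 (3 ≡ᵇ toℕ j)
      ≡⟨ lookup∘tabulate (λ j → 24 * 𝟙 (3 ≡ᵇ toℕ j)) j ⟨
    lookup (lookup M1 (Fin.fromℕ 4)) j ∎
    where open ≡-Reasoning

  count-row₁ : ∀ v j → countB (λ e → D (v ⊕ e) ≡ᵇ toℕ j) (sphere 24 1) ≡ lookup (lookup M1 (colour v)) j
  count-row₁ v j = [ (λ D≤3 → count-row≤3 M1 (neighbourCount₁ 24) 1 v j D≤3 M1-row (countB-D-sphere₁ v (_≡ᵇ toℕ j) D≤3))
                   , (λ D≡4 → at-deep-hole v M1 j D≡4 (count-row₁-deep v D≡4 j)) ]′ (D≤3⊎D≡4 v)

  count-row₂-deep : ∀ v → D v ≡ 4 → ∀ j →
    countB (λ e → D (v ⊕ e) ≡ᵇ toℕ j) (sphere 24 2) ≡ lookup (lookup M2 (Fin.fromℕ 4)) j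
  count-row₂-deep v D≡4 j = trans (Sextet.count-row₂ v D≡4 (toℕ j) (toℕ j ≟ 2) (toℕ j ≟ 4))
    (sym (lookup∘tabulate (λ j → 36 * 𝟙 (toℕ j ≡ᵇ 2) + 240 * 𝟙 (toℕ j ≡ᵇ 4)) j))

  count-row₂ : ∀ v j → countB (λ e → D (v ⊕ e) ≡ᵇ toℕ j) (sphere 24 2) ≡ lookup (lookup M2 (colour v)) j
  count-row₂ v j = [ (λ D≤3 → count-row≤3 M2 (neighbourCount₂ 24) 2 v j D≤3 M2-row (countB-D-sphere₂ v (_≡ᵇ toℕ j) D≤3))
                   , (λ D≡4 → at-deep-hole v M2 j D≡4 (count-row₂-deep v D≡4 j)) ]′ (D≤3⊎D≡4 v)

  count-adjacent : ∀ (adj : Word 24 → Word 24 → Bool) k → (∀ v u → adj v u ≡ (ρ v u ≡ᵇ k)) → ∀ v j →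
    countB (λ (u : Word 24) → allV u ∧ adj v u ∧ ⌊ colour u Fin.≟ j ⌋) (allWords 24) ≡ countB (λ e → D (v ⊕ e) ≡ᵇ toℕ j) (sphere 24 k)
  count-adjacent adj k adj≡ v j = trans (countB-adjacent 24 k v allV (adj v) (λ u → ⌊ colour u Fin.≟ j ⌋) (adj≡ v))
    (countB-cong {p = λ e → allV (v ⊕ e) ∧ ⌊ colour (v ⊕ e) Fin.≟ j ⌋} {q = λ e → D (v ⊕ e) ≡ᵇ toℕ j} (sphere 24 k)
      λ e _ → trans (⌊≟⌋≡toℕ≡ᵇ (colour (v ⊕ e)) j) (cong (_≡ᵇ toℕ j) (toℕ-colour (v ⊕ e))))

  D-firstOnes : ∀ k → k ≤ 4 → D (firstOnes k 24) ≡ k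
  D-firstOnes k k≤4 = trans (D≡ρ (firstOnes k 24) 0∈F (≤-trans (≤-reflexive ρ≡k) k≤4)) ρ≡k
    where
    ρ≡k : ρ (firstOnes k 24) (zeros 24) ≡ k
    ρ≡k = trans (ρ-zerosʳ (firstOnes k 24)) (weight-firstOnes k 24 (≤-trans k≤4 (m≤m+n 4 20)))

  colour-onto : ∀ j → ∃ λ v → allV v ≡ true × colour v ≡ j
  colour-onto j = firstOnes (toℕ j) 24 , refl , toℕ-injective (trans (toℕ-colour (firstOnes (toℕ j) 24)) (D-firstOnes (toℕ j) (≤-pred (toℕ<n j))))

  colour-perfect₁ : PerfectColoring allV adjQ colour M1
  colour-perfect₁ = colour-onto , λ v _ j → trans (count-adjacent adjQ 1 (λ _ _ → refl) v j) (count-row₁ v j)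

  colour-perfect₂ : PerfectColoring allV adjQ2 colour M2
  colour-perfect₂ = colour-onto , λ v _ j → trans (count-adjacent adjQ2 2 (λ _ _ → refl) v j) (count-row₂ v j)

  ψ : ℕ → Fin 2
  ψ 1 = zero
  ψ _ = suc zero

  oddColour : Word 24 → Fin 2
  oddColour v = ψ (D v)

  oddColour-spec : ∀ v → oddWeight v ≡ true → (oddColour v ≡ zero × D v ≡ 1) ⊎ (oddColour v ≡ suc zero × D v ≡ 3)
  oddColour-spec v v-odd = Sum.map (λ D≡1 → cong ψ D≡1 , D≡1) (λ D≡3 → cong ψ D≡3 , D≡3) (D-odd v v-odd)

  M3-row : ∀ {d} j → d ≡ 1 ⊎ d ≡ 3 → neighbourCount₂ 24 d (λ x → ⌊ ψ (φ x) Fin.≟ j ⌋) ≡ lookup (lookup M3 (ψ d)) j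
  M3-row zero (inj₁ refl) = refl
  M3-row (suc zero) (inj₁ refl) = refl
  M3-row zero (inj₂ refl) = refl
  M3-row (suc zero) (inj₂ refl) = refl

  oddColour-count : ∀ v → oddWeight v ≡ true → ∀ j →
    countB (λ (u : Word 24) → oddWeight u ∧ adjQ2 v u ∧ ⌊ oddColour u Fin.≟ j ⌋) (allWords 24) ≡ lookup (lookup M3 (oddColour v)) j
  oddColour-count v v-odd j = begin
    countB (λ (u : Word 24) → oddWeight u ∧ adjQ2 v u ∧ ⌊ oddColour u Fin.≟ j ⌋) (allWords 24)
      ≡⟨ countB-adjacent 24 2 v oddWeight (adjQ2 v) (λ u → ⌊ oddColour u Fin.≟ j ⌋) (λ _ → refl) ⟩
    countB (λ e → oddWeight (v ⊕ e) ∧ ⌊ oddColour (v ⊕ e) Fin.≟ j ⌋) (sphere 24 2)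
      ≡⟨ countB-cong {p = λ e → oddWeight (v ⊕ e) ∧ ⌊ oddColour (v ⊕ e) Fin.≟ j ⌋} {q = λ e → ⌊ ψ (D (v ⊕ e)) Fin.≟ j ⌋}
           (sphere 24 2) (λ e e∈ → cong (_∧ ⌊ oddColour (v ⊕ e) Fin.≟ j ⌋) (odd-translate e∈)) ⟩
    countB (λ e → ⌊ ψ (D (v ⊕ e)) Fin.≟ j ⌋) (sphere 24 2)
      ≡⟨ countB-D-sphere₂ v (λ x → ⌊ ψ x Fin.≟ j ⌋) (D-odd≤3 v v-odd) ⟩
    neighbourCount₂ 24 (D v) (λ x → ⌊ ψ (φ x) Fin.≟ j ⌋)
      ≡⟨ M3-row j (D-odd v v-odd) ⟩
    lookup (lookup M3 (oddColour v)) j ∎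
    where
    open ≡-Reasoning
    odd-translate : ∀ {e} → e ∈ sphere 24 2 → oddWeight (v ⊕ e) ≡ true
    odd-translate {e} e∈ = trans (isOdd-weight-⊕ v e) (cong₂ _xor_ v-odd (cong isOdd (∈-sphere⁻ 2 e∈)))

  oddColour-onto : ∀ j → ∃ λ v → oddWeight v ≡ true × oddColour v ≡ j
  oddColour-onto zero = firstOnes 1 24 , refl , cong ψ (D-firstOnes 1 (s≤s z≤n))
  oddColour-onto (suc zero) = firstOnes 3 24 , refl , cong ψ (D-firstOnes 3 (s≤s (s≤s (s≤s z≤n))))

  oddColour-perfect : PerfectColoring oddWeight adjQ2 oddColour M3
  oddColour-perfect = oddColour-onto , oddColour-count

triples : List (Word 8)
triples = sphere 8 3

covers : List (Word 8) → Word 8 → Bool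
covers S t = any (λ s → ρ t s ≡ᵇ 1) S

compatible : List (Word 8) → Word 8 → Bool
compatible S B = all (λ s → 4 ≤ᵇ ρ B s) S

-- Completes a partial Steiner system S(3, 4, 8) on the given triples: each triple not yet covered by a chosen
-- block of weight 4 is covered by one of its weight-4 extensions compatible with the blocks already chosen.
search : List (Word 8) → List (Word 8) → List (List (Word 8))
extend : List (Word 8) → List (Word 8) → Word 8 → List (List (Word 8))

search [] S = S ∷ []
search (t ∷ ts) S = if covers S t then search ts S else concatMap (extend ts S) (map (t ⊕_) (sphere 8 1))

extend ts S B = if (weight B ≡ᵇ 4) ∧ compatible S B then search ts (B ∷ S) else []

blockSystems : List (List (Word 8))
blockSystems = search triples []

withEnds : List (Word 8) → List (Word 8)
withEnds S = zeros 8 ∷ ones 8 ∷ S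

_∈ᵇ_ : ∀ {n} → Word n → List (Word n) → Bool
w ∈ᵇ L = any (λ s → ρ w s ≡ᵇ 0) L

∈ᵇ⇒∈ : ∀ {n} {w : Word n} L → (w ∈ᵇ L) ≡ true → w ∈ L
∈ᵇ⇒∈ {w = w} L eq = let s , s∈ , ρ≡ᵇ0 = any-true⁻ (λ s → ρ w s ≡ᵇ 0) L eq in
  subst (_∈ L) (sym (ρ≡0⇒≡ w s (≡ᵇ-true⇒≡ ρ≡ᵇ0))) s∈

∈⇒∈ᵇ : ∀ {n} {w : Word n} {L} → w ∈ L → (w ∈ᵇ L) ≡ true
∈⇒∈ᵇ {w = w} w∈ = any-true⁺ (λ s → ρ w s ≡ᵇ 0) w∈ (≡⇒≡ᵇ-true (ρ-self w))

closedᵇ : List (Word 8) → Bool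
closedᵇ L = all (λ a → all (λ b → (a ⊕ b) ∈ᵇ L) L) L

disjointᵇ : List (Word 8) → List (Word 8) → Bool
disjointᵇ S S' = all (λ s → not (s ∈ᵇ S')) S

noTriangleᵇ : List (Word 8) → List (Word 8) → Bool
noTriangleᵇ S L = all (λ a → all (λ b → not (weight (a ⊕ b) ≡ᵇ 2) ∨
  all (λ c → not ((weight (a ⊕ c) ≡ᵇ 2) ∧ (weight (a ⊕ b ⊕ c) ≡ᵇ 2))) L) L) S

_⇒ᵇ_ : Bool → Bool → Bool
a ⇒ᵇ b = not a ∨ b

⇒ᵇ-mp : ∀ {a b} → (a ⇒ᵇ b) ≡ true → a ≡ true → b ≡ true
⇒ᵇ-mp eq refl = eq

-- The block systems found are the 30 extended Hamming codes: linear, with blocks of weight 4.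
linearᵇ : List (Word 8) → Bool
linearᵇ S = all (λ s → weight s ≡ᵇ 4) S ∧ closedᵇ (withEnds S)

blockSystems-linear : all linearᵇ blockSystems ≡ true
blockSystems-linear = refl

turynᵇ : List (Word 8) → List (Word 8) → Bool
turynᵇ S S' = disjointᵇ S S' ⇒ᵇ noTriangleᵇ S (withEnds S')

blockSystems-turyn : all (λ S → all (turynᵇ S) blockSystems) blockSystems ≡ true
blockSystems-turyn = refl

adjacent-tripleᵇ : Word 8 → Bool
adjacent-tripleᵇ w = (weight w ≡ᵇ 4) ⇒ᵇ any (λ t → ρ t w ≡ᵇ 1) triples

weight4-adjacent-triple : all adjacent-tripleᵇ (allWords 8) ≡ true
weight4-adjacent-triple = refl

four-triplesᵇ : Word 8 → Bool
four-triplesᵇ B = (weight B ≡ᵇ 4) ⇒ᵇ (countB (λ t → ρ t B ≡ᵇ 1) triples ≡ᵇ 4)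

weight4-four-triples : all four-triplesᵇ (allWords 8) ≡ true
weight4-four-triples = refl

others-55ᵇ : Word 8 → Bool
others-55ᵇ t = countB (λ s → not (ρ s t ≡ᵇ 0)) triples ≡ᵇ 55

triples-others : all others-55ᵇ triples ≡ true
triples-others = refl

-- An (8, 16, 4)-code through 0 and 1 consists of 0, 1 and 14 words of weight 4 which, as 4-subsets, cover every
-- 3-subset (a block of weight 4 covers 4 triples and distinct blocks share none, so 14 of them cover all 56), and
-- the search through these Steiner systems S(3, 4, 8) must therefore have found it.
module BlockSystem (C : List (Word 8)) (C-code : IsCode 8 16 4 C) (0∈C : zeros 8 ∈ C) (1∈C : ones 8 ∈ C) where

  C-unique : Unique C
  C-unique = code-unique (proj₂ C-code)

  C-distance : ∀ {a b} → a ∈ C → b ∈ C → a ≢ b → 4 ≤ ρ a b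
  C-distance = code-distance (proj₂ C-code)

  shape : ∀ {w} → w ∈ C → w ≡ zeros 8 ⊎ w ≡ ones 8 ⊎ weight w ≡ 4
  shape {w} w∈ with w ≟ʷ zeros 8 | w ≟ʷ ones 8
  ... | yes w≡0 | _ = inj₁ w≡0
  ... | no _ | yes w≡1 = inj₂ (inj₁ w≡1)
  ... | no w≢0 | no w≢1 = inj₂ (inj₂ (≤-antisym weight≤4 (subst (4 ≤_) (ρ-zerosʳ w) (C-distance w∈ 0∈C w≢0))))
    where
    weight≤4 : weight w ≤ 4
    weight≤4 = +-cancelʳ-≤ 4 (weight w) 4 (subst (weight w + 4 ≤_) (weight-complement w)
                 (+-monoʳ-≤ (weight w) (C-distance w∈ 1∈C w≢1)))

  isBlock : Word 8 → Bool
  isBlock w = weight w ≡ᵇ 4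

  blocks : List (Word 8)
  blocks = filterᵇ isBlock C

  ∈-blocks⁻ : ∀ {B} → B ∈ blocks → B ∈ C × weight B ≡ 4
  ∈-blocks⁻ {B} B∈ = let B∈C , w≡ᵇ4 = ∈-filter⁻ (λ w → T? (isBlock w)) B∈ in B∈C , ≡ᵇ⇒≡ (weight B) 4 w≡ᵇ4

  14≤length-blocks : 14 ≤ length blocks
  14≤length-blocks = subst (14 ≤_) (sym (length-filterᵇ isBlock C))
    (+-cancelʳ-≤ (countB (λ w → not (isBlock w)) C) 14 (countB isBlock C)
      (≤-trans (+-monoʳ-≤ 14 non-blocks≤2) (≤-reflexive (sym (trans (countB-complement isBlock C) (proj₁ C-code))))))
    where
    non-blocks : List (Word 8)
    non-blocks = filterᵇ (λ w → not (isBlock w)) C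
    non-block-ends : ∀ x → x ∈ non-blocks → x ∈ zeros 8 ∷ ones 8 ∷ []
    non-block-ends x x∈ with ∈-filter⁻ (λ w → T? (not (isBlock w))) x∈
    ... | x∈C , not-block with shape x∈C
    ...   | inj₁ refl = here refl
    ...   | inj₂ (inj₁ refl) = there (here refl)
    ...   | inj₂ (inj₂ w≡4) = ⊥-elim (subst (λ n → Data.Bool.T (not (n ≡ᵇ 4))) w≡4 not-block)
    non-blocks≤2 : countB (λ w → not (isBlock w)) C ≤ 2
    non-blocks≤2 = subst (_≤ 2) (length-filterᵇ (λ w → not (isBlock w)) C)
      (Unique-length≤countB (λ _ → true) non-blocks (zeros 8 ∷ ones 8 ∷ [])
        (Unique.filter⁺ (λ w → T? (not (isBlock w))) C-unique) non-block-ends (λ _ _ → refl))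

  triples-adjacent : Word 8 → List (Word 8)
  triples-adjacent B = filterᵇ (λ t → ρ t B ≡ᵇ 1) triples

  ∈-triples-adjacent⁻ : ∀ B {t} → t ∈ triples-adjacent B → t ∈ triples × ρ t B ≡ 1
  ∈-triples-adjacent⁻ B {t} t∈ = let t∈₃ , ρ≡ᵇ1 = ∈-filter⁻ (λ t → T? (ρ t B ≡ᵇ 1)) t∈ in t∈₃ , ≡ᵇ⇒≡ (ρ t B) 1 ρ≡ᵇ1

  blocks-apart : ∀ {B B' t} → B ∈ C → B' ∈ C → B ≢ B' → ρ t B ≡ 1 → ρ t B' ≡ 1 → ⊥
  blocks-apart {B} {B'} {t} B∈ B'∈ B≢B' ρtB≡1 ρtB'≡1 = <⇒≱ (s≤s (s≤s (s≤s z≤n))) (begin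
    4             ≤⟨ C-distance B∈ B'∈ B≢B' ⟩
    ρ B B'        ≤⟨ ρ-triangle B t B' ⟩
    ρ B t + ρ t B' ≡⟨ cong₂ _+_ (trans (ρ-sym B t) ρtB≡1) ρtB'≡1 ⟩
    2             ∎)
    where open ≤-Reasoning

  triple-covered : ∀ {t} → t ∈ triples → ∃ λ B → B ∈ C × weight B ≡ 4 × ρ t B ≡ 1
  triple-covered {t} t∈ with any (λ B → isBlock B ∧ (ρ t B ≡ᵇ 1)) C in covered
  ... | true = let B , B∈ , both = any-true⁻ (λ B → isBlock B ∧ (ρ t B ≡ᵇ 1)) C covered in
    B , B∈ , ≡ᵇ-true⇒≡ (∧-conicalˡ (isBlock B) (ρ t B ≡ᵇ 1) both) , ≡ᵇ-true⇒≡ (∧-conicalʳ (isBlock B) (ρ t B ≡ᵇ 1) both)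
  ... | false = ⊥-elim (1+n≰n (begin
    56                          ≤⟨ *-monoˡ-≤ 4 14≤length-blocks ⟩
    length blocks * 4           ≡⟨ length-concatMap triples-adjacent blocks 4 four-each ⟨
    length adjacent             ≤⟨ Unique-length≤countB (λ s → not (ρ s t ≡ᵇ 0)) adjacent triples adjacent-unique
                                     (λ s s∈ → proj₁ (∈-adjacent⁻ s∈)) (λ s s∈ → proj₂ (∈-adjacent⁻ s∈)) ⟩
    countB (λ s → not (ρ s t ≡ᵇ 0)) triples ≡⟨ ≡ᵇ-true⇒≡ (all-true⁻ others-55ᵇ triples triples-others t∈) ⟩
    55                          ∎))
    where
    open ≤-Reasoning
    adjacent : List (Word 8)
    adjacent = concatMap triples-adjacent blocks
    four-each : ∀ B → B ∈ blocks → length (triples-adjacent B) ≡ 4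
    four-each B B∈ = trans (length-filterᵇ (λ t → ρ t B ≡ᵇ 1) triples)
      (≡ᵇ-true⇒≡ (⇒ᵇ-mp (all-true⁻ four-triplesᵇ (allWords 8) weight4-four-triples (∈-allWords B)) (≡⇒≡ᵇ-true (proj₂ (∈-blocks⁻ B∈)))))
    adjacent-unique : Unique adjacent
    adjacent-unique = Unique-concatMap triples-adjacent blocks (Unique.filter⁺ (λ w → T? (isBlock w)) C-unique)
      (λ B _ → Unique.filter⁺ (λ s → T? (ρ s B ≡ᵇ 1)) (sphere-unique 8 3))
      (λ B B' s B∈ B'∈ B≢B' s∈B s∈B' → blocks-apart {t = s} (proj₁ (∈-blocks⁻ B∈)) (proj₁ (∈-blocks⁻ B'∈)) B≢B'
        (proj₂ (∈-triples-adjacent⁻ B s∈B)) (proj₂ (∈-triples-adjacent⁻ B' s∈B')))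
    ∈-adjacent⁻ : ∀ {s} → s ∈ adjacent → s ∈ triples × not (ρ s t ≡ᵇ 0) ≡ true
    ∈-adjacent⁻ {s} s∈ with ∈-concatMap⁻′ triples-adjacent blocks s∈
    ... | B , B∈ , s∈B with ∈-triples-adjacent⁻ B s∈B
    ...   | s∈₃ , ρsB≡1 = s∈₃ , s≢t
      where
      s≢t : not (ρ s t ≡ᵇ 0) ≡ true
      s≢t with ρ s t ≡ᵇ 0 in ρ≡ᵇ0
      ... | false = refl
      ... | true with ρ≡0⇒≡ s t (≡ᵇ-true⇒≡ ρ≡ᵇ0)
      ...   | refl = ⊥-elim (false≢true (trans (sym covered)
                       (any-true⁺ (λ B → isBlock B ∧ (ρ s B ≡ᵇ 1)) (proj₁ (∈-blocks⁻ B∈))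
                         (cong₂ _∧_ (≡⇒≡ᵇ-true {weight B} (proj₂ (∈-blocks⁻ B∈))) (≡⇒≡ᵇ-true {ρ s B} ρsB≡1)))))
        where
        false≢true : false ≢ true
        false≢true ()

  Found : List (Word 8) → List (Word 8) → Set
  Found ts S = ∃ λ S' → S' ∈ search ts S × (∀ {s} → s ∈ S' → s ∈ C)
                      × (∀ {t} → t ∈ ts → covers S' t ≡ true) × (∀ {s} → s ∈ S → s ∈ S')

  covers-mono : ∀ {S S' t} → (∀ {s} → s ∈ S → s ∈ S') → covers S t ≡ true → covers S' t ≡ true
  covers-mono {S} {S'} {t} S⊆S' covered = let s , s∈ , ρ≡ᵇ1 = any-true⁻ (λ s → ρ t s ≡ᵇ 1) S covered in
    any-true⁺ (λ s → ρ t s ≡ᵇ 1) (S⊆S' s∈) ρ≡ᵇ1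

  search-complete : ∀ ts S → (∀ {s} → s ∈ S → s ∈ C) → (∀ {t} → t ∈ ts → t ∈ triples) → Found ts S
  search-complete [] S S⊆C _ = S , here refl , S⊆C , (λ ()) , (λ s∈ → s∈)
  search-complete (t ∷ ts) S S⊆C ts⊆triples with covers S t in t-covered
  ... | true = let S' , S'∈ , S'⊆C , covers-ts , S⊆S' = search-complete ts S S⊆C (λ t∈ → ts⊆triples (there t∈)) in
    S' , S'∈ , S'⊆C ,
    (λ { (here refl) → covers-mono {t = t} S⊆S' t-covered ; (there t∈) → covers-ts t∈ }) , S⊆S'
  ... | false = let B , B∈C , weight≡4 , ρtB≡1 = triple-covered (ts⊆triples (here refl))
                    S' , S'∈ , S'⊆C , covers-ts , BS⊆S' = search-complete ts (B ∷ S) (λ { (here refl) → B∈C ; (there s∈) → S⊆C s∈ })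
                                                          (λ t∈ → ts⊆triples (there t∈)) in
    S' , ∈-concatMap⁺′ {h = extend ts S} (B-extends ρtB≡1) (subst (λ b → S' ∈ (if b then search ts (B ∷ S) else [])) (sym (B-admissible B∈C weight≡4 ρtB≡1)) S'∈) ,
    S'⊆C , (λ { (here refl) → any-true⁺ (λ s → ρ t s ≡ᵇ 1) (BS⊆S' (here refl)) (≡⇒≡ᵇ-true ρtB≡1) ; (there t∈) → covers-ts t∈ }) ,
    (λ s∈ → BS⊆S' (there s∈))
    where
    B-extends : ∀ {B} → ρ t B ≡ 1 → B ∈ map (t ⊕_) (sphere 8 1)
    B-extends {B} ρtB≡1 = subst (_∈ map (t ⊕_) (sphere 8 1)) (⊕-involutiveˡ t B) (∈-map⁺ (t ⊕_) (∈-sphere⁺ 1 (t ⊕ B) ρtB≡1))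
    B-admissible : ∀ {B} → B ∈ C → weight B ≡ 4 → ρ t B ≡ 1 → ((weight B ≡ᵇ 4) ∧ compatible S B) ≡ true
    B-admissible {B} B∈C weight≡4 ρtB≡1 = cong₂ _∧_ (≡⇒≡ᵇ-true weight≡4)
      (all-true⁺ (λ s → 4 ≤ᵇ ρ B s) S λ s s∈ → Equivalence.to T-≡ (≤⇒≤ᵇ (C-distance B∈C (S⊆C s∈) (B≢ s∈))))
      where
      B≢ : ∀ {s} → s ∈ S → B ≢ s
      B≢ s∈ refl with trans (sym t-covered) (any-true⁺ (λ s → ρ t s ≡ᵇ 1) s∈ (≡⇒≡ᵇ-true ρtB≡1))
      ... | ()

  abstract
    system-found : Found triples []
    system-found = search-complete triples [] (λ ()) (λ t∈ → t∈)

  system : List (Word 8)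
  system = proj₁ system-found

  system∈blockSystems : system ∈ blockSystems
  system∈blockSystems = proj₁ (proj₂ system-found)

  system⊆C : ∀ {s} → s ∈ system → s ∈ C
  system⊆C = proj₁ (proj₂ (proj₂ system-found))

  system-covers : ∀ {t} → t ∈ triples → covers system t ≡ true
  system-covers = proj₁ (proj₂ (proj₂ (proj₂ system-found)))

  system-linear : linearᵇ system ≡ true
  system-linear = all-true⁻ linearᵇ blockSystems blockSystems-linear system∈blockSystems

  system-block : ∀ {s} → s ∈ system → weight s ≡ 4
  system-block s∈ = ≡ᵇ-true⇒≡ (all-true⁻ (λ s → weight s ≡ᵇ 4) system
    (∧-conicalˡ (all (λ s → weight s ≡ᵇ 4) system) (closedᵇ (withEnds system)) system-linear) s∈)

  ∈withEnds⇒∈C : ∀ {w} → w ∈ withEnds system → w ∈ C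
  ∈withEnds⇒∈C (here refl) = 0∈C
  ∈withEnds⇒∈C (there (here refl)) = 1∈C
  ∈withEnds⇒∈C (there (there w∈)) = system⊆C w∈

  block∈system : ∀ {w} → w ∈ C → weight w ≡ 4 → w ∈ system
  block∈system {w} w∈ weight≡4 =
    let t , t∈ , ρtw≡ᵇ1 = any-true⁻ (λ t → ρ t w ≡ᵇ 1) triples
          (⇒ᵇ-mp {weight w ≡ᵇ 4} (all-true⁻ adjacent-tripleᵇ (allWords 8) weight4-adjacent-triple (∈-allWords w)) (≡⇒≡ᵇ-true weight≡4))
        s , s∈ , ρts≡ᵇ1 = any-true⁻ (λ s → ρ t s ≡ᵇ 1) system (system-covers t∈)
    in subst (_∈ system) (decidable-stable (s ≟ʷ w)
         (λ s≢w → blocks-apart {t = t} (system⊆C s∈) w∈ s≢w (≡ᵇ-true⇒≡ ρts≡ᵇ1) (≡ᵇ-true⇒≡ ρtw≡ᵇ1))) s∈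

  ∈C⇒∈withEnds : ∀ {w} → w ∈ C → w ∈ withEnds system
  ∈C⇒∈withEnds w∈ = by-shape w∈ (shape w∈)
    where
    by-shape : ∀ {w} → w ∈ C → w ≡ zeros 8 ⊎ w ≡ ones 8 ⊎ weight w ≡ 4 → w ∈ withEnds system
    by-shape _ (inj₁ refl) = here refl
    by-shape _ (inj₂ (inj₁ refl)) = there (here refl)
    by-shape w∈ (inj₂ (inj₂ weight≡4)) = there (there (block∈system w∈ weight≡4))

  C-closed : ∀ {a b} → a ∈ C → b ∈ C → a ⊕ b ∈ C
  C-closed {a} {b} a∈ b∈ = ∈withEnds⇒∈C (∈ᵇ⇒∈ (withEnds system)
    (all-true⁻ (λ b → (a ⊕ b) ∈ᵇ withEnds system) (withEnds system)
      (all-true⁻ (λ a → all (λ b → (a ⊕ b) ∈ᵇ withEnds system) (withEnds system)) (withEnds system) closed (∈C⇒∈withEnds a∈))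
      (∈C⇒∈withEnds b∈)))
    where
    closed : closedᵇ (withEnds system) ≡ true
    closed = ∧-conicalʳ (all (λ s → weight s ≡ᵇ 4) system) (closedᵇ (withEnds system)) system-linear

  C-even : ∀ {w} → w ∈ C → oddWeight w ≡ false
  C-even w∈ with shape w∈
  ... | inj₁ refl = refl
  ... | inj₂ (inj₁ refl) = refl
  ... | inj₂ (inj₂ weight≡4) = cong isOdd weight≡4

even-weight : ∀ {n} → isOdd n ≡ false → n ≢ 0 → n ≡ 2 ⊎ 4 ≤ n
even-weight {0} _ n≢0 = ⊥-elim (n≢0 refl)
even-weight {2} _ _ = inj₁ refl
even-weight {suc (suc (suc (suc n)))} _ _ = inj₂ (s≤s (s≤s (s≤s (s≤s z≤n))))
even-weight {1} () _
even-weight {3} () _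

turynWord : Word 8 → Word 8 → Word 8 → Word 24
turynWord x y z = (x ⊕ y) ++ (x ⊕ z) ++ (x ⊕ y ⊕ z)

ρ-turynWord : ∀ x y z x' y' z' → ρ (turynWord x y z) (turynWord x' y' z') ≡
  weight ((x ⊕ x') ⊕ (y ⊕ y')) + (weight ((x ⊕ x') ⊕ (z ⊕ z')) + weight ((x ⊕ x') ⊕ (y ⊕ y') ⊕ (z ⊕ z')))
ρ-turynWord x y z x' y' z' = begin
  ρ ((x ⊕ y) ++ (x ⊕ z) ++ (x ⊕ y ⊕ z)) ((x' ⊕ y') ++ (x' ⊕ z') ++ (x' ⊕ y' ⊕ z'))
    ≡⟨ ρ-++ (x ⊕ y) (x' ⊕ y') ((x ⊕ z) ++ (x ⊕ y ⊕ z)) ((x' ⊕ z') ++ (x' ⊕ y' ⊕ z')) ⟩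
  ρ (x ⊕ y) (x' ⊕ y') + ρ ((x ⊕ z) ++ (x ⊕ y ⊕ z)) ((x' ⊕ z') ++ (x' ⊕ y' ⊕ z'))
    ≡⟨ cong (ρ (x ⊕ y) (x' ⊕ y') +_) (ρ-++ (x ⊕ z) (x' ⊕ z') (x ⊕ y ⊕ z) (x' ⊕ y' ⊕ z')) ⟩
  ρ (x ⊕ y) (x' ⊕ y') + (ρ (x ⊕ z) (x' ⊕ z') + ρ (x ⊕ y ⊕ z) (x' ⊕ y' ⊕ z'))
    ≡⟨ cong₂ _+_ (cong weight (⊕-interchange x y x' y'))
         (cong₂ _+_ (cong weight (⊕-interchange x z x' z'))
           (cong weight (trans (⊕-interchange (x ⊕ y) z (x' ⊕ y') z') (cong (_⊕ (z ⊕ z')) (⊕-interchange x y x' y'))))) ⟩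
  weight ((x ⊕ x') ⊕ (y ⊕ y')) + (weight ((x ⊕ x') ⊕ (z ⊕ z')) + weight ((x ⊕ x') ⊕ (y ⊕ y') ⊕ (z ⊕ z'))) ∎
  where open ≡-Reasoning

module Turyn (C C' : List (Word 8)) (C-code : IsCode 8 16 4 C) (C'-code : IsCode 8 16 4 C')
  (C∩C' : ∀ (w : Word 8) → ((w ∈ C × w ∈ C') → (w ≡ zeros 8 ⊎ w ≡ ones 8))
                         × ((w ≡ zeros 8 ⊎ w ≡ ones 8) → (w ∈ C × w ∈ C'))) where

  0∈ : zeros 8 ∈ C × zeros 8 ∈ C'
  0∈ = proj₂ (C∩C' (zeros 8)) (inj₁ refl)

  1∈ : ones 8 ∈ C × ones 8 ∈ C'
  1∈ = proj₂ (C∩C' (ones 8)) (inj₂ refl)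

  module K = BlockSystem C C-code (proj₁ 0∈) (proj₁ 1∈)
  module K' = BlockSystem C' C'-code (proj₂ 0∈) (proj₂ 1∈)

  no-common-block : ∀ {w} → weight w ≡ 4 → w ∈ C → w ∈ C' → ⊥
  no-common-block weight≡4 w∈C w∈C' with proj₁ (C∩C' _) (w∈C , w∈C')
  no-common-block () _ _ | inj₁ refl
  no-common-block () _ _ | inj₂ refl

  systems-disjoint : disjointᵇ K.system K'.system ≡ true
  systems-disjoint = all-true⁺ (λ s → not (s ∈ᵇ K'.system)) K.system λ s s∈ → not-shared s∈ (s ∈ᵇ K'.system) refl
    where
    not-shared : ∀ {s} → s ∈ K.system → ∀ b → (s ∈ᵇ K'.system) ≡ b → not b ≡ true
    not-shared _ false _ = refl
    not-shared {s} s∈ true s∈ᵇ = ⊥-elim (no-common-block (K.system-block s∈) (K.system⊆C s∈) (K'.system⊆C (∈ᵇ⇒∈ K'.system s∈ᵇ)))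

  no-triangle : noTriangleᵇ K.system (withEnds K'.system) ≡ true
  no-triangle = ⇒ᵇ-mp {disjointᵇ K.system K'.system}
    (all-true⁻ (turynᵇ K.system) blockSystems
      (all-true⁻ (λ S → all (turynᵇ S) blockSystems) blockSystems blockSystems-turyn K.system∈blockSystems)
      K'.system∈blockSystems)
    systems-disjoint

  nonzero-weight≥4 : ∀ {x} → x ∈ C' → x ≢ zeros 8 → 4 ≤ weight x
  nonzero-weight≥4 x∈ x≢0 with K'.shape x∈
  ... | inj₁ x≡0 = ⊥-elim (x≢0 x≡0)
  ... | inj₂ (inj₁ refl) = s≤s (s≤s (s≤s (s≤s z≤n)))
  ... | inj₂ (inj₂ weight≡4) = ≤-reflexive (sym weight≡4)

  weights-at-0 : ∀ {b c} → b ∈ C' → c ∈ C' → ¬ (b ≡ zeros 8 × c ≡ zeros 8) → 8 ≤ weight b + (weight c + weight (b ⊕ c))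
  weights-at-0 {b} {c} b∈ c∈ not-both with b ≟ʷ zeros 8 | c ≟ʷ zeros 8
  ... | yes refl | yes refl = ⊥-elim (not-both (refl , refl))
  ... | yes refl | no c≢0 rewrite ⊕-identityˡ c = +-mono-≤ (nonzero-weight≥4 c∈ c≢0) (nonzero-weight≥4 c∈ c≢0)
  ... | no b≢0 | yes refl rewrite ⊕-identityʳ b = +-mono-≤ (nonzero-weight≥4 b∈ b≢0) (nonzero-weight≥4 b∈ b≢0)
  ... | no b≢0 | no c≢0 = ≤-trans (+-mono-≤ (nonzero-weight≥4 b∈ b≢0) (nonzero-weight≥4 c∈ c≢0)) (+-monoʳ-≤ (weight b) (m≤m+n (weight c) _))

  weights-at-1 : ∀ {p q} → p ∈ C' → q ∈ C' → 8 ≤ weight p + (weight q + weight ((p ⊕ q) ⊕ ones 8))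
  weights-at-1 {p} {q} p∈ q∈ with p ≟ʷ zeros 8 | q ≟ʷ zeros 8
  ... | yes refl | _ rewrite ⊕-identityˡ q = ≤-reflexive (sym (weight-complement q))
  ... | no p≢0 | yes refl rewrite ⊕-identityʳ p = ≤-reflexive (sym (weight-complement p))
  ... | no p≢0 | no q≢0 = ≤-trans (+-mono-≤ (nonzero-weight≥4 p∈ p≢0) (nonzero-weight≥4 q∈ q≢0)) (+-monoʳ-≤ (weight p) (m≤m+n (weight q) _))

  ones-⊕ : ∀ (b c : Word 8) → ones 8 ⊕ b ⊕ c ≡ ((ones 8 ⊕ b) ⊕ (ones 8 ⊕ c)) ⊕ ones 8
  ones-⊕ b c = begin
    ones 8 ⊕ b ⊕ c                        ≡⟨ cong (ones 8 ⊕ b ⊕_) (⊕-involutiveˡ (ones 8) c) ⟨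
    (ones 8 ⊕ b) ⊕ (ones 8 ⊕ (ones 8 ⊕ c)) ≡⟨ cong ((ones 8 ⊕ b) ⊕_) (⊕-comm (ones 8) (ones 8 ⊕ c)) ⟩
    (ones 8 ⊕ b) ⊕ ((ones 8 ⊕ c) ⊕ ones 8) ≡⟨ ⊕-assoc (ones 8 ⊕ b) (ones 8 ⊕ c) (ones 8) ⟨
    ((ones 8 ⊕ b) ⊕ (ones 8 ⊕ c)) ⊕ ones 8 ∎
    where open ≡-Reasoning

  C'-closed-apart : ∀ {a x} → weight a ≡ 4 → a ∈ C → x ∈ C' → weight (a ⊕ x) ≢ 0
  C'-closed-apart {a} {x} weight≡4 a∈ x∈ weight≡0 =
    no-common-block weight≡4 a∈ (subst (_∈ C') (sym (⊕≡zeros⇒≡ a x (weight≡0⇒zeros (a ⊕ x) weight≡0))) x∈)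

  even-⊕ : ∀ {a x} → a ∈ C → x ∈ C' → isOdd (weight (a ⊕ x)) ≡ false
  even-⊕ {a} {x} a∈ x∈ = trans (isOdd-weight-⊕ a x) (cong₂ _xor_ (K.C-even a∈) (K'.C-even x∈))

  -- Three weights at least 2 sum to at least 8 unless all equal 2, which the computed check excludes for blocks.
  weights-at-block : ∀ {a b c} → a ∈ K.system → b ∈ C' → c ∈ C' → 8 ≤ weight (a ⊕ b) + (weight (a ⊕ c) + weight (a ⊕ b ⊕ c))
  weights-at-block {a} {b} {c} a∈ b∈ c∈ =
    by-weights (even-weight (even-⊕ a∈C b∈) (C'-closed-apart weight≡4 a∈C b∈))
               (even-weight (even-⊕ a∈C c∈) (C'-closed-apart weight≡4 a∈C c∈))
               (even-weight even-abc (λ w≡0 → C'-closed-apart weight≡4 a∈C (K'.C-closed b∈ c∈) (trans (cong weight (sym (⊕-assoc a b c))) w≡0)))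
    where
    a∈C = K.system⊆C a∈
    weight≡4 = K.system-block a∈
    even-abc : isOdd (weight (a ⊕ b ⊕ c)) ≡ false
    even-abc = trans (cong (λ w → isOdd (weight w)) (⊕-assoc a b c)) (even-⊕ a∈C (K'.C-closed b∈ c∈))
    2≤ : ∀ {n} → n ≡ 2 ⊎ 4 ≤ n → 2 ≤ n
    2≤ (inj₁ refl) = ≤-refl
    2≤ (inj₂ 4≤n) = ≤-trans (s≤s (s≤s z≤n)) 4≤n
    triangle-free : weight (a ⊕ b) ≡ 2 → weight (a ⊕ c) ≡ 2 → weight (a ⊕ b ⊕ c) ≡ 2 → ⊥
    triangle-free w₁ w₂ w₃ = false≢true (trans (sym (cong₂ (λ x y → not (x ∧ y)) (≡⇒≡ᵇ-true w₂) (≡⇒≡ᵇ-true w₃)))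
      (all-true⁻ (λ c → not ((weight (a ⊕ c) ≡ᵇ 2) ∧ (weight (a ⊕ b ⊕ c) ≡ᵇ 2))) (withEnds K'.system)
        (⇒ᵇ-mp {weight (a ⊕ b) ≡ᵇ 2}
          (all-true⁻ (λ b → (weight (a ⊕ b) ≡ᵇ 2) ⇒ᵇ all (λ c → not ((weight (a ⊕ c) ≡ᵇ 2) ∧ (weight (a ⊕ b ⊕ c) ≡ᵇ 2))) (withEnds K'.system))
            (withEnds K'.system)
            (all-true⁻ (λ a → all (λ b → (weight (a ⊕ b) ≡ᵇ 2) ⇒ᵇ all (λ c → not ((weight (a ⊕ c) ≡ᵇ 2) ∧ (weight (a ⊕ b ⊕ c) ≡ᵇ 2)))
                         (withEnds K'.system)) (withEnds K'.system)) K.system no-triangle a∈)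
            (K'.∈C⇒∈withEnds b∈))
          (≡⇒≡ᵇ-true w₁))
        (K'.∈C⇒∈withEnds c∈)))
      where
      false≢true : false ≢ true
      false≢true ()
    by-weights : weight (a ⊕ b) ≡ 2 ⊎ 4 ≤ weight (a ⊕ b) → weight (a ⊕ c) ≡ 2 ⊎ 4 ≤ weight (a ⊕ c) →
      weight (a ⊕ b ⊕ c) ≡ 2 ⊎ 4 ≤ weight (a ⊕ b ⊕ c) → 8 ≤ weight (a ⊕ b) + (weight (a ⊕ c) + weight (a ⊕ b ⊕ c))
    by-weights (inj₂ 4≤) w₂ w₃ = +-mono-≤ 4≤ (+-mono-≤ (2≤ w₂) (2≤ w₃))
    by-weights w₁ (inj₂ 4≤) w₃ = ≤-trans (+-mono-≤ (2≤ w₁) (+-mono-≤ 4≤ (2≤ w₃))) (≤-reflexive refl)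
    by-weights w₁ w₂ (inj₂ 4≤) = +-mono-≤ (2≤ w₁) (+-mono-≤ (2≤ w₂) 4≤)
    by-weights (inj₁ w₁) (inj₁ w₂) (inj₁ w₃) = ⊥-elim (triangle-free w₁ w₂ w₃)

  turyn-weight : ∀ {a b c} → a ∈ C → b ∈ C' → c ∈ C' → ¬ (a ≡ zeros 8 × b ≡ zeros 8 × c ≡ zeros 8) →
    8 ≤ weight (a ⊕ b) + (weight (a ⊕ c) + weight (a ⊕ b ⊕ c))
  turyn-weight {a} {b} {c} a∈ b∈ c∈ not-all with K.shape a∈
  ... | inj₁ refl rewrite ⊕-identityˡ b | ⊕-identityˡ c = weights-at-0 b∈ c∈ (λ (b≡0 , c≡0) → not-all (refl , b≡0 , c≡0))
  ... | inj₂ (inj₁ refl) rewrite ones-⊕ b c =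
    weights-at-1 (K'.C-closed (proj₂ 1∈) b∈) (K'.C-closed (proj₂ 1∈) c∈)
  ... | inj₂ (inj₂ weight≡4) = weights-at-block (K.block∈system a∈ weight≡4) b∈ c∈

  F : List (Word 24)
  F = Fset C C'

  ∈F⁻ : ∀ {f} → f ∈ F → ∃ λ x → ∃ λ y → ∃ λ z → x ∈ C × y ∈ C' × z ∈ C' × f ≡ turynWord x y z
  ∈F⁻ f∈ with ∈-concatMap⁻′ (λ x → concatMap (λ y → map (turynWord x y) C') C') C f∈
  ... | x , x∈ , f∈x with ∈-concatMap⁻′ (λ y → map (turynWord x y) C') C' f∈x
  ...   | y , y∈ , f∈xy with ∈-map⁻ (turynWord x y) f∈xy
  ...     | z , z∈ , f≡ = x , y , z , x∈ , y∈ , z∈ , f≡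

  turynWord-distance : ∀ {x y z x' y' z'} → x ∈ C → y ∈ C' → z ∈ C' → x' ∈ C → y' ∈ C' → z' ∈ C' →
    ¬ (x ≡ x' × y ≡ y' × z ≡ z') → 8 ≤ ρ (turynWord x y z) (turynWord x' y' z')
  turynWord-distance {x} {y} {z} {x'} {y'} {z'} x∈ y∈ z∈ x'∈ y'∈ z'∈ differ =
    subst (8 ≤_) (sym (ρ-turynWord x y z x' y' z'))
      (turyn-weight (K.C-closed x∈ x'∈) (K'.C-closed y∈ y'∈) (K'.C-closed z∈ z'∈)
        (λ (x≡ , y≡ , z≡) → differ (⊕≡zeros⇒≡ x x' x≡ , ⊕≡zeros⇒≡ y y' y≡ , ⊕≡zeros⇒≡ z z' z≡)))

  turynWord-injective : ∀ {x y z x' y' z'} → x ∈ C → y ∈ C' → z ∈ C' → x' ∈ C → y' ∈ C' → z' ∈ C' →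
    turynWord x y z ≡ turynWord x' y' z' → x ≡ x' × y ≡ y' × z ≡ z'
  turynWord-injective {x} {y} {z} {x'} {y'} {z'} x∈ y∈ z∈ x'∈ y'∈ z'∈ eq = decidable-stable
    (x ≟ʷ x' ×-dec y ≟ʷ y' ×-dec z ≟ʷ z')
    (λ differ → <⇒≱ (s≤s z≤n) (subst (8 ≤_) (trans (cong (ρ (turynWord x y z)) (sym eq)) (ρ-self (turynWord x y z)))
                                (turynWord-distance x∈ y∈ z∈ x'∈ y'∈ z'∈ differ)))

  F-distance : ∀ {f g} → f ∈ F → g ∈ F → f ≢ g → 8 ≤ ρ f g
  F-distance f∈ g∈ f≢g with ∈F⁻ f∈ | ∈F⁻ g∈
  ... | x , y , z , x∈ , y∈ , z∈ , refl | x' , y' , z' , x'∈ , y'∈ , z'∈ , refl =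
    turynWord-distance x∈ y∈ z∈ x'∈ y'∈ z'∈ λ { (refl , refl , refl) → f≢g refl }

  F-unique : Unique F
  F-unique = Unique-concatMap _ C K.C-unique
    (λ x x∈ → Unique-concatMap _ C' K'.C-unique
      (λ y y∈ → Unique-map (turynWord x y) C' K'.C-unique λ z z' z∈ z'∈ eq → proj₂ (proj₂ (turynWord-injective x∈ y∈ z∈ x∈ y∈ z'∈ eq)))
      (λ y y' w y∈ y'∈ y≢y' w∈y w∈y' → apart-y x∈ y∈ y'∈ y≢y' w∈y w∈y'))
    (λ x x' w x∈ x'∈ x≢x' w∈x w∈x' → apart-x x∈ x'∈ x≢x' w∈x w∈x')
    where
    apart-y : ∀ {x y y' w} → x ∈ C → y ∈ C' → y' ∈ C' → y ≢ y' → w ∈ map (turynWord x y) C' → w ∈ map (turynWord x y') C' → ⊥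
    apart-y {x} {y} {y'} x∈ y∈ y'∈ y≢y' w∈y w∈y' with ∈-map⁻ (turynWord x y) w∈y | ∈-map⁻ (turynWord x y') w∈y'
    ... | z , z∈ , refl | z' , z'∈ , eq = y≢y' (proj₁ (proj₂ (turynWord-injective x∈ y∈ z∈ x∈ y'∈ z'∈ eq)))
    apart-x : ∀ {x x' w} → x ∈ C → x' ∈ C → x ≢ x' → w ∈ concatMap (λ y → map (turynWord x y) C') C' →
      w ∈ concatMap (λ y → map (turynWord x' y) C') C' → ⊥
    apart-x {x} {x'} x∈ x'∈ x≢x' w∈x w∈x' with ∈-concatMap⁻′ (λ y → map (turynWord x y) C') C' w∈x | ∈-concatMap⁻′ (λ y → map (turynWord x' y) C') C' w∈x'
    ... | y , y∈ , w∈xy | y' , y'∈ , w∈x'y' with ∈-map⁻ (turynWord x y) w∈xy | ∈-map⁻ (turynWord x' y') w∈x'y'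
    ...   | z , z∈ , refl | z' , z'∈ , eq = x≢x' (proj₁ (turynWord-injective x∈ y∈ z∈ x'∈ y'∈ z'∈ eq))

  F-length : length F ≡ 4096
  F-length = trans (length-concatMap _ C 256 λ x _ → trans (length-concatMap _ C' 16 λ y _ →
                      trans (length-map (turynWord x y) C') (proj₁ C'-code)) (cong (_* 16) (proj₁ C'-code)))
                   (cong (_* 256) (proj₁ C-code))

  F-code : IsCode 24 4096 8 F
  F-code = F-length , AllPairs-fromUnique F F-unique F-distance

  0∈F : zeros 24 ∈ F
  0∈F = ∈-concatMap⁺′ (proj₁ 0∈) (∈-concatMap⁺′ (proj₂ 0∈) (∈-map⁺ (turynWord (zeros 8) (zeros 8)) (proj₂ 0∈)))

  F-even : ∀ f → f ∈ F → oddWeight f ≡ false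
  F-even f f∈ with ∈F⁻ f∈
  ... | x , y , z , x∈ , y∈ , z∈ , refl = begin
    oddWeight ((x ⊕ y) ++ (x ⊕ z) ++ (x ⊕ y ⊕ z))
      ≡⟨ cong isOdd (trans (weight-++ (x ⊕ y) _) (cong (weight (x ⊕ y) +_) (weight-++ (x ⊕ z) (x ⊕ y ⊕ z)))) ⟩
    isOdd (weight (x ⊕ y) + (weight (x ⊕ z) + weight (x ⊕ y ⊕ z)))
      ≡⟨ trans (isOdd-+ (weight (x ⊕ y)) _) (cong (oddWeight (x ⊕ y) xor_) (isOdd-+ (weight (x ⊕ z)) _)) ⟩
    oddWeight (x ⊕ y) xor (oddWeight (x ⊕ z) xor oddWeight (x ⊕ y ⊕ z))
      ≡⟨ cong₂ _xor_ (even-⊕ x∈ y∈) (cong₂ _xor_ (even-⊕ x∈ z∈) (trans (cong oddWeight (⊕-assoc x y z)) (even-⊕ x∈ (K'.C-closed y∈ z∈)))) ⟩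
    false ∎
    where open ≡-Reasoning

lemma3 : (C C' : List (Word 8)) → IsCode 8 16 4 C → IsCode 8 16 4 C' →
    (∀ (w : Word 8) → ((w ∈ C × w ∈ C') → (w ≡ zeros 8 ⊎ w ≡ ones 8))
                      × ((w ≡ zeros 8 ⊎ w ≡ ones 8) → (w ∈ C × w ∈ C'))) →
    (Σ (Word 24 → Fin 5) λ T →
        (∀ v → toℕ (T v) ≡ distTo (Fset C C') v)
        × PerfectColoring allV adjQ T M1
        × PerfectColoring allV adjQ2 T M2)
    × (Σ (Word 24 → Fin 2) λ T' →
        (∀ v → oddWeight v ≡ true →
           (T' v ≡ zero × distTo (Fset C C') v ≡ 1)
           ⊎ (T' v ≡ suc zero × distTo (Fset C C') v ≡ 3))
        × PerfectColoring oddWeight adjQ2 T' M3)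
lemma3 C C' C-code C'-code C∩C' =
  (colour , toℕ-colour , colour-perfect₁ , colour-perfect₂) , (oddColour , oddColour-spec , oddColour-perfect)
  where
  open Turyn C C' C-code C'-code C∩C' using (F-code; 0∈F; F-even)
  open DistanceColouring (Fset C C') F-code 0∈F F-even
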